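{- Let $H$ be a right star with at least one edge, let $d=d_1,d_2,\ldots$ be a sequence of positive integers, and let $i,j$ be non-negative integers with $j\le i+1$. Then there is a left determiner for $(H,H_i(d))$, and, if $j\ge2$, there is a right determiner for $(H,H_i^j(d))$.
   Context: An ordered graph is a finite simple graph together with a linear order of its vertex set. A copy of an ordered graph $G$ in $F$ is a subgraph of $F$ (with inherited order) isomorphic to $G$ via an order-preserving bijection. A right star is an ordered star with all leaves to the right of its center; $\vec S_p$ is the right star with $p$ edges. The concatenation $G\circ G'$ is obtained from the vertex-disjoint union of $G$ and $G'$, with all vertices of $G$ before all vertices of $G'$, by identifying the rightmost vertex of $G$ with the leftmost vertex of $G'$. For $1\le j\le i$ let $H_i(d)=\vec S_{d_i}\circ\cdots\circ\vec S_{d_1}$ and $H_i^j(d)=\vec S_{d_i}\circ\cdots\circ\vec S_{d_j}$; $H_0(d)$ and $H_i^{i+1}(d)$ denote the single-vertex ordered graph. In a red/blue edge-coloring, a blue copy of a graph is "induced and isolated in the blue subgraph" if it is an induced subgraph of the graph formed by the blue edges and is a connected component of that graph. For $i\ge0$, a left determiner for $(H,H_i(d))$ is an ordered graph $F$ such that (1) every red/blue coloring of the edges of $F$ without a red copy of $H$ has a blue copy of $H_i(d)$ containing the leftmost vertex of $F$, and (2) there is a red/blue coloring of the edges of $F$ with no red copy of $H$ and no blue copy of $H_{i+1}(d)$ in which there is a unique blue copy of $H_i(d)$ containing the leftmost vertex of $F$, and this copy is induced and isolated in the blue subgraph. For $1\le j\le i+1$, a right determiner for $(H,H_i^j(d))$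 is an ordered graph $F$ such that (1) every red/blue coloring of the edges of $F$ with no red copy of $H$ and no blue copy of $H_i(d)$ has a blue copy of $H_i^j(d)$ containing the rightmost vertex of $F$, and (2) there is a red/blue coloring of the edges of $F$ with no red copy of $H$ and no blue copy of $H_i(d)$ in which there is a unique blue copy of $H_i^j(d)$ containing the rightmost vertex of $F$, and this copy is induced and isolated in the blue subgraph. -}

module Defs where

open import Data.Nat using (ℕ; zero; suc; _+_; _∸_; _≤_; _<_; _<?_; _≤?_; _≡ᵇ_)
open import Data.Bool using (Bool; true; false; if_then_else_)
open import Data.Product using (Σ; ∃; _×_; _,_)
open import Data.Sum using (_⊎_)
open import Relation.Nullary using (¬_)
open import Relation.Nullary.Decidable using (⌊_⌋)
open import Relation.Binary.PropositionalEquality using (_≡_)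

-- An ordered graph: vertex set {0,1,...,n-1} with the natural order.
-- The edge set is { {u,v} : u < v < n, E u v ≡ true }; values of E
-- outside u < v < n are irrelevant.  (Simple: no loops, no multi-edges.)
record OGraph : Set where
  constructor mkOGraph
  field
    n : ℕ
    E : ℕ → ℕ → Bool
open OGraph public

Edge : OGraph → ℕ → ℕ → Set
Edge G u v = u < v × v < n G × E G u v ≡ true

point : OGraph
point = mkOGraph 1 (λ _ _ → false)

rightStar : ℕ → OGraph
rightStar p = mkOGraph (suc p) (λ u v → u ≡ᵇ 0)

-- concatenation G ∘ G' (for nonempty G, G'): vertices of G are 0..nG-1,
-- vertices of G' are shifted by nG-1, so the rightmost vertex of G is
-- identified with the leftmost vertex of G'.
_∘ᵒ_ : OGraph → OGraph → OGraph
G ∘ᵒ G' = mkOGraph (n G + n G' ∸ 1) e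
  where
    s : ℕ
    s = n G ∸ 1
    e : ℕ → ℕ → Bool
    e u v = if ⌊ v <? n G ⌋ then E G u v
            else (if ⌊ s ≤? u ⌋ then E G' (u ∸ s) (v ∸ s) else false)

-- Hseg d j k = S_{d_{j+k-1}} ∘ ... ∘ S_{d_j}  (k stars), point if k = 0
Hseg : (ℕ → ℕ) → ℕ → ℕ → OGraph
Hseg d j zero = point
Hseg d j (suc zero) = rightStar (d j)
Hseg d j (suc (suc k)) = rightStar (d (j + suc k)) ∘ᵒ Hseg d j (suc k)

-- H_i^j(d) = S_{d_i} ∘ ... ∘ S_{d_j}  (single vertex when j = i+1)
Hij : (ℕ → ℕ) → ℕ → ℕ → OGraph
Hij d i j = Hseg d j (suc i ∸ j)

Hi : (ℕ → ℕ) → ℕ → OGraph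
Hi d i = Hij d i 1

data Color : Set where
  red blue : Color

-- a red/blue colouring of the edges of F: the colour of edge {u,v}, u<v,
-- is c u v (values elsewhere are irrelevant)
Coloring : Set
Coloring = ℕ → ℕ → Color

-- φ is an order-preserving embedding of G into F mapping edges to edges;
-- the corresponding copy of G in F is the image subgraph.
Embedding : OGraph → OGraph → (ℕ → ℕ) → Set
Embedding G F φ =
  (∀ x → x < n G → φ x < n F) ×
  (∀ x y → x < y → y < n G → φ x < φ y) ×
  (∀ x y → Edge G x y → Edge F (φ x) (φ y))

MonoCopy : Color → OGraph → OGraph → Coloring → (ℕ → ℕ) → Set
MonoCopy col G F c φ =
  Embedding G F φ × (∀ x y → Edge G x y → c (φ x) (φ y) ≡ col)

HasMonoCopy : Color → OGraph → OGraph → Coloring → Set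
HasMonoCopy col G F c = ∃ λ φ → MonoCopy col G F c φ

InCopy : OGraph → (ℕ → ℕ) → ℕ → Set
InCopy G φ u = ∃ λ x → x < n G × φ x ≡ u

ContainsLeftmost : OGraph → OGraph → (ℕ → ℕ) → Set
ContainsLeftmost G F φ = InCopy G φ 0

ContainsRightmost : OGraph → OGraph → (ℕ → ℕ) → Set
ContainsRightmost G F φ = InCopy G φ (n F ∸ 1)

-- the copy φ is induced in the blue subgraph and is a connected component
-- of it: every blue edge between copy vertices is an edge of the copy, and
-- no blue edge joins a copy vertex to a non-copy vertex.
-- (The copies considered, of H_i^j(d), are connected.)
InducedIsolatedBlue : OGraph → OGraph → Coloring → (ℕ → ℕ) → Set
InducedIsolatedBlue G F c φ =
  (∀ x y → x < n G → y < n G → Edge F (φ x) (φ y) → c (φ x) (φ y) ≡ blue → Edge G x y) ×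
  (∀ u v → Edge F u v → c u v ≡ blue →
     (InCopy G φ u ⊎ InCopy G φ v) → InCopy G φ u × InCopy G φ v)

-- uniqueness of copies (a copy is determined by its order-preserving
-- embedding restricted to the vertices of G)
SameCopy : OGraph → (ℕ → ℕ) → (ℕ → ℕ) → Set
SameCopy G φ ψ = ∀ x → x < n G → φ x ≡ ψ x

LeftDeterminer : OGraph → (ℕ → ℕ) → ℕ → OGraph → Set
LeftDeterminer H d i F =
  (∀ (c : Coloring) → ¬ HasMonoCopy red H F c →
     ∃ λ φ → MonoCopy blue (Hi d i) F c φ × ContainsLeftmost (Hi d i) F φ) ×
  (∃ λ (c : Coloring) →
     ¬ HasMonoCopy red H F c ×
     ¬ HasMonoCopy blue (Hi d (suc i)) F c ×
     (∃ λ φ → MonoCopy blue (Hi d i) F c φ × ContainsLeftmost (Hi d i) F φ ×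
        (∀ ψ → MonoCopy blue (Hi d i) F c ψ → ContainsLeftmost (Hi d i) F ψ →
           SameCopy (Hi d i) φ ψ) ×
        InducedIsolatedBlue (Hi d i) F c φ))

RightDeterminer : OGraph → (ℕ → ℕ) → ℕ → ℕ → OGraph → Set
RightDeterminer H d i j F =
  (∀ (c : Coloring) → ¬ HasMonoCopy red H F c → ¬ HasMonoCopy blue (Hi d i) F c →
     ∃ λ φ → MonoCopy blue (Hij d i j) F c φ × ContainsRightmost (Hij d i j) F φ) ×
  (∃ λ (c : Coloring) →
     ¬ HasMonoCopy red H F c ×
     ¬ HasMonoCopy blue (Hi d i) F c ×
     (∃ λ φ → MonoCopy blue (Hij d i j) F c φ × ContainsRightmost (Hij d i j) F φ ×
        (∀ ψ → MonoCopy blue (Hij d i j) F c ψ → ContainsRightmost (Hij d i j) F ψ →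
           SameCopy (Hij d i j) φ ψ) ×
        InducedIsolatedBlue (Hij d i j) F c φ))

-- Every determiner comes from one construction. To an ordered graph B attach a row of blocks, namely m
-- single vertices, then p - 1 copies of a left determiner L, then a block T, and join the last vertex of B
-- (the hub) to the first vertex of every block. Without a red p-star at most p - 1 of the m + p hub edges are
-- red, so at least m + 1 are blue, and the (m + 1)-st of them enters a copy of L, where L forces a blue copy
-- at its first vertex: a blue star with m + 1 leaves at the hub continues into that forced copy. In the good
-- colouring exactly the hub edges into the copies of L are red and the parts keep their good colourings, so
-- the only blue copy through the hub is the star onto the single vertices and T followed by the distinguished
-- copy in T, and it is an isolated blue component.
--
-- With B a single vertex, T = L a left determiner for H_{i-1} and m + 1 = d_i this is a left determiner for
-- H_i = S_{d_i} ∘ H_{i-1}. With B a right determiner for H_i^{j+1}, T a single vertex, L a left determiner for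
-- H_{j-1} and m + 1 = d_j, the last hub edge must be blue, for otherwise the blue star would reach a copy of L
-- and complete a blue H_i = H_i^j ∘ H_{j-1}; so the copy of H_i^{j+1} ending at the hub extends to a blue
-- H_i^j = H_i^{j+1} ∘ S_{d_j} ending at the last vertex.

module Submission where

open import Defs
open import Data.Nat
open import Data.Nat.Properties
open import Data.Bool using (Bool; true; false)
open import Data.Bool.Properties using (not-¬)
open import Data.Maybe using (Maybe; just; nothing)
open import Data.Product
open import Data.Sum
open import Data.Empty
open import Relation.Nullary
open import Relation.Binary using (tri<; tri≈; tri>)
open import Relation.Binary.PropositionalEquality

-- Concatenated stars

Hseg-last : (ℕ → ℕ) → ℕ → ℕ → ℕ
Hseg-last d j zero = 0
Hseg-last d j (suc k) = d (j + k) + Hseg-last d j k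

n-Hseg : ∀ d j k → n (Hseg d j k) ≡ suc (Hseg-last d j k)
n-Hseg d j zero = refl
n-Hseg d j (suc zero) = cong suc (trans (cong d (sym (+-identityʳ j))) (sym (+-identityʳ _)))
n-Hseg d j (suc (suc k)) rewrite n-Hseg d j (suc k) = +-suc _ _

n-Hseg-suc : ∀ d j k → n (Hseg d j (suc k)) ≡ d (j + k) + n (Hseg d j k)
n-Hseg-suc d j k rewrite n-Hseg d j (suc k) | n-Hseg d j k = sym (+-suc _ _)

Hseg-last-+ : ∀ d j a b → Hseg-last d j (a + b) ≡ Hseg-last d (j + b) a + Hseg-last d j b
Hseg-last-+ d j zero b = refl
Hseg-last-+ d j (suc a) b rewrite Hseg-last-+ d j a b | +-assoc j b a | +-comm b a =
  sym (+-assoc (d (j + (a + b))) (Hseg-last d (j + b) a) (Hseg-last d j b))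

≡ᵇ0⇒≡0 : ∀ u → (u ≡ᵇ 0) ≡ true → u ≡ 0
≡ᵇ0⇒≡0 zero _ = refl
≡ᵇ0⇒≡0 (suc u) ()

point-edgeless : ∀ u v → ¬ Edge point u v
point-edgeless u v (u<v , s≤s z≤n , _) = n≮0 u<v

Edge⇒<n : ∀ {G u v} → Edge G u v → v < n G
Edge⇒<n (_ , v<n , _) = v<n

Edge⇒source<n : ∀ {G u v} → Edge G u v → u < n G
Edge⇒source<n (u<v , v<n , _) = <-trans u<v v<n

rightStar-edge⁻ : ∀ q u v → Edge (rightStar q) u v → u ≡ 0 × Σ ℕ λ v' → v ≡ suc v' × v' < q
rightStar-edge⁻ q u zero (() , _ , _)
rightStar-edge⁻ q u (suc v) (_ , s≤s v<q , e) = ≡ᵇ0⇒≡0 u e , v , refl , v<q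

rightStar-edge : ∀ q v → v < q → Edge (rightStar q) 0 (suc v)
rightStar-edge q v v<q = z<s , s≤s v<q , refl

Hseg-suc-edge⁻ : ∀ d j k u v → Edge (Hseg d j (suc k)) u v →
  (u ≡ 0 × 0 < v × v ≤ d (j + k)) ⊎
  (Σ ℕ λ u' → Σ ℕ λ v' → u ≡ d (j + k) + u' × v ≡ d (j + k) + v' × Edge (Hseg d j k) u' v')
Hseg-suc-edge⁻ d j zero u v (u<v , v<n , e) rewrite +-identityʳ j =
  inj₁ (≡ᵇ0⇒≡0 u e , ≤-<-trans z≤n u<v , ≤-pred v<n)
Hseg-suc-edge⁻ d j (suc k) u v (u<v , v<n , e) with v <? suc (d (j + suc k))
... | yes v≤D = inj₁ (≡ᵇ0⇒≡0 u e , ≤-<-trans z≤n u<v , ≤-pred v≤D)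
... | no _ with d (j + suc k) ≤? u
...   | no _ = ⊥-elim (not-¬ refl e)
...   | yes D≤u = inj₂ (u ∸ D , v ∸ D , sym (m+[n∸m]≡n D≤u) , sym (m+[n∸m]≡n D≤v) ,
                        ∸-monoˡ-< u<v D≤u , v∸D<n , e)
  where
  D = d (j + suc k)
  D≤v : D ≤ v
  D≤v = ≤-trans D≤u (<⇒≤ u<v)
  v∸D<n : v ∸ D < n (Hseg d j (suc k))
  v∸D<n = +-cancelˡ-< D _ _ (subst₂ _<_ (sym (m+[n∸m]≡n D≤v)) (n-Hseg-suc d j (suc k)) v<n)

Hseg-suc-star-edge : ∀ d j k v → 0 < v → v ≤ d (j + k) → Edge (Hseg d j (suc k)) 0 v
Hseg-suc-star-edge d j zero v 0<v v≤D rewrite +-identityʳ j = 0<v , s≤s v≤D , refl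
Hseg-suc-star-edge d j (suc k) v 0<v v≤D with v <? suc (d (j + suc k))
... | yes _ = 0<v , subst (v <_) (sym (n-Hseg-suc d j (suc k)))
                         (≤-<-trans v≤D (m<m+n _ (subst (0 <_) (sym (n-Hseg d j (suc k))) z<s))) , refl
... | no v≰D = ⊥-elim (v≰D (s≤s v≤D))

Hseg-suc-shift-edge : ∀ d j k u' v' → Edge (Hseg d j k) u' v' →
  Edge (Hseg d j (suc k)) (d (j + k) + u') (d (j + k) + v')
Hseg-suc-shift-edge d j zero u' v' e = ⊥-elim (point-edgeless u' v' e)
Hseg-suc-shift-edge d j (suc k) u' v' (u<v , v<n , e) with (d (j + suc k) + v') <? suc (d (j + suc k))
... | yes lt = ⊥-elim (<-irrefl refl (<-≤-trans (m<m+n _ (≤-<-trans z≤n u<v)) (≤-pred lt)))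
... | no _ with d (j + suc k) ≤? d (j + suc k) + u'
...   | no D≰ = ⊥-elim (D≰ (m≤m+n _ _))
...   | yes _ rewrite m+n∸m≡n (d (j + suc k)) u' | m+n∸m≡n (d (j + suc k)) v' =
          +-monoʳ-< (d (j + suc k)) u<v ,
          subst (d (j + suc k) + v' <_) (sym (n-Hseg-suc d j (suc k))) (+-monoʳ-< (d (j + suc k)) v<n) , e

record Split (G G₁ G₂ : OGraph) (N₁ N₂ : ℕ) : Set where
  field
    n-whole : n G ≡ suc (N₁ + N₂)
    n-left : n G₁ ≡ suc N₁
    n-right : n G₂ ≡ suc N₂
    edge-split : ∀ u v → Edge G u v →
      Edge G₁ u v ⊎ (Σ ℕ λ u' → Σ ℕ λ v' → u ≡ N₁ + u' × v ≡ N₁ + v' × Edge G₂ u' v')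
    edge-left : ∀ u v → Edge G₁ u v → Edge G u v
    edge-right : ∀ u v → Edge G₂ u v → Edge G (N₁ + u) (N₁ + v)

Hseg-split : ∀ d j a b → Split (Hseg d j (a + b)) (Hseg d (j + b) a) (Hseg d j b)
                               (Hseg-last d (j + b) a) (Hseg-last d j b)
Hseg-split d j zero b = record
  { n-whole = n-Hseg d j b ; n-left = refl ; n-right = n-Hseg d j b
  ; edge-split = λ u v e → inj₂ (u , v , refl , refl , e)
  ; edge-left = λ u v e → ⊥-elim (point-edgeless u v e)
  ; edge-right = λ u v e → e }
Hseg-split d j (suc a) b = record
  { n-whole = trans (n-Hseg d j (suc a + b)) (cong suc (Hseg-last-+ d j (suc a) b))
  ; n-left = n-Hseg d (j + b) (suc a)
  ; n-right = n-Hseg d j b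
  ; edge-split = split ; edge-left = left ; edge-right = right }
  where
  module S = Split (Hseg-split d j a b)
  D = d (j + (a + b))
  N = Hseg-last d (j + b) a
  same-star : d (j + b + a) ≡ D
  same-star = cong d (trans (+-assoc j b a) (cong (j +_) (+-comm b a)))
  split : ∀ u v → Edge (Hseg d j (suc a + b)) u v → Edge (Hseg d (j + b) (suc a)) u v ⊎
          (Σ ℕ λ u' → Σ ℕ λ v' → u ≡ d (j + b + a) + N + u' × v ≡ d (j + b + a) + N + v' × Edge (Hseg d j b) u' v')
  split u v e with Hseg-suc-edge⁻ d j (a + b) u v e
  ... | inj₁ (refl , 0<v , v≤D) =
        inj₁ (Hseg-suc-star-edge d (j + b) a v 0<v (subst (v ≤_) (sym same-star) v≤D))
  ... | inj₂ (u' , v' , refl , refl , e') with S.edge-split u' v' e'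
  ...   | inj₁ e₁ = inj₁ (subst (λ z → Edge (Hseg d (j + b) (suc a)) (z + u') (z + v')) same-star
                               (Hseg-suc-shift-edge d (j + b) a u' v' e₁))
  ...   | inj₂ (u'' , v'' , refl , refl , e₂) =
          inj₂ (u'' , v'' , reassoc u'' , reassoc v'' , e₂)
    where reassoc : ∀ x → D + (N + x) ≡ d (j + b + a) + N + x
          reassoc x = trans (sym (+-assoc D N x)) (cong (λ z → z + N + x) (sym same-star))
  left : ∀ u v → Edge (Hseg d (j + b) (suc a)) u v → Edge (Hseg d j (suc a + b)) u v
  left u v e with Hseg-suc-edge⁻ d (j + b) a u v e
  ... | inj₁ (refl , 0<v , v≤D) = Hseg-suc-star-edge d j (a + b) v 0<v (subst (v ≤_) same-star v≤D)
  ... | inj₂ (u' , v' , refl , refl , e') =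
        subst (λ z → Edge (Hseg d j (suc a + b)) (z + u') (z + v')) (sym same-star)
              (Hseg-suc-shift-edge d j (a + b) u' v' (S.edge-left u' v' e'))
  right : ∀ u v → Edge (Hseg d j b) u v →
          Edge (Hseg d j (suc a + b)) (d (j + b + a) + N + u) (d (j + b + a) + N + v)
  right u v e rewrite same-star | +-assoc D N u | +-assoc D N v =
    Hseg-suc-shift-edge d j (a + b) (N + u) (N + v) (S.edge-right u v e)

LeftRooted : OGraph → Set
LeftRooted G = ∀ x → 0 < x → x < n G → Σ ℕ λ y → y < x × Edge G y x

rightStar-leftRooted : ∀ q → LeftRooted (rightStar q)
rightStar-leftRooted q x 0<x x<n = 0 , 0<x , 0<x , x<n , refl

Hseg-leftRooted : ∀ d j k → LeftRooted (Hseg d j k)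
Hseg-leftRooted d j zero x 0<x (s≤s x≤0) = ⊥-elim (<-irrefl refl (≤-trans 0<x x≤0))
Hseg-leftRooted d j (suc k) x 0<x x<n with x ≤? d (j + k)
... | yes x≤D = 0 , 0<x , Hseg-suc-star-edge d j k x 0<x x≤D
... | no x≰D = D + y , subst (D + y <_) D+x'≡x (+-monoʳ-< D y<x') ,
               subst (Edge (Hseg d j (suc k)) (D + y)) D+x'≡x (Hseg-suc-shift-edge d j k y x' e)
  where
  D = d (j + k)
  x' = x ∸ D
  D<x = ≰⇒> x≰D
  D+x'≡x : D + x' ≡ x
  D+x'≡x = m+[n∸m]≡n (<⇒≤ D<x)
  x'<n : x' < n (Hseg d j k)
  x'<n = +-cancelˡ-< D _ _ (subst₂ _<_ (sym D+x'≡x) (n-Hseg-suc d j k) x<n)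
  0<x' : 0 < x'
  0<x' = +-cancelˡ-< D 0 x' (subst₂ _<_ (sym (+-identityʳ D)) (sym D+x'≡x) D<x)
  parent = Hseg-leftRooted d j k x' 0<x' x'<n
  y = proj₁ parent
  y<x' = proj₁ (proj₂ parent)
  e = proj₂ (proj₂ parent)

Hseg-split-firstStar : ∀ d j b m → d (j + b) ≡ suc m →
  Split (Hseg d j (suc b)) (rightStar (suc m)) (Hseg d j b) (suc m) (Hseg-last d j b)
Hseg-split-firstStar d j b m d≡ =
  subst₂ (λ q N → Split (Hseg d j (suc b)) (rightStar q) (Hseg d j b) N (Hseg-last d j b))
         d≡ (trans (+-identityʳ _) (trans (cong d (+-identityʳ (j + b))) d≡)) (Hseg-split d j 1 b)

Hseg-split-lastStar : ∀ d j k m → d j ≡ suc m →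
  Split (Hseg d j (suc k)) (Hseg d (suc j) k) (rightStar (suc m)) (Hseg-last d (suc j) k) (suc m)
Hseg-split-lastStar d j k m d≡ =
  subst (λ a → Split (Hseg d j a) (Hseg d (suc j) k) (rightStar (suc m)) (Hseg-last d (suc j) k) (suc m)) (+-comm k 1)
  (subst (λ b → Split (Hseg d j (k + 1)) (Hseg d b k) (rightStar (suc m)) (Hseg-last d b k) (suc m)) (+-comm j 1)
    (subst₂ (λ q N → Split (Hseg d j (k + 1)) (Hseg d (j + 1) k) (rightStar q) (Hseg-last d (j + 1) k) N)
            d≡ (trans (+-identityʳ _) d≡') (Hseg-split d j k 1)))
  where d≡' = trans (cong d (+-identityʳ j)) d≡

-- Strictly increasing maps

StrictMonoOn : ℕ → (ℕ → ℕ) → Set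
StrictMonoOn N φ = ∀ x y → x < y → y < N → φ x < φ y

strictMonoOn⇒monoOn : ∀ {N φ} → StrictMonoOn N φ → ∀ x y → x ≤ y → y < N → φ x ≤ φ y
strictMonoOn⇒monoOn mono x y x≤y y<N with m≤n⇒m<n∨m≡n x≤y
... | inj₁ x<y = <⇒≤ (mono x y x<y y<N)
... | inj₂ refl = ≤-refl

strictMonoOn-+ : ∀ {N φ} → StrictMonoOn N φ → ∀ x k → x + k < N → φ x + k ≤ φ (x + k)
strictMonoOn-+ {φ = φ} mono x zero _ rewrite +-identityʳ x | +-identityʳ (φ x) = ≤-refl
strictMonoOn-+ {φ = φ} mono x (suc k) lt rewrite +-suc (φ x) k | +-suc x k =
  ≤-trans (s≤s (strictMonoOn-+ mono x k (<-trans (n<1+n (x + k)) lt)))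
          (mono (x + k) (suc (x + k)) ≤-refl lt)

strictMonoOn-id≤ : ∀ {N φ} → StrictMonoOn N φ → ∀ x → x < N → x ≤ φ x
strictMonoOn-id≤ mono x lt = ≤-trans (m≤n+m x _) (strictMonoOn-+ mono 0 x lt)

strictMonoOn-injective : ∀ {N φ} → StrictMonoOn N φ → ∀ x y → x < N → y < N → φ x ≡ φ y → x ≡ y
strictMonoOn-injective mono x y x<N y<N eq with <-cmp x y
... | tri< x<y _ _ = ⊥-elim (<-irrefl eq (mono x y x<y y<N))
... | tri≈ _ x≡y _ = x≡y
... | tri> _ _ y<x = ⊥-elim (<-irrefl (sym eq) (mono y x y<x x<N))

strictMonoOn-reflects-< : ∀ {N φ} → StrictMonoOn N φ → ∀ x y → x < N → φ x < φ y → x < y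
strictMonoOn-reflects-< mono x y x<N φx<φy with <-cmp x y
... | tri< x<y _ _ = x<y
... | tri≈ _ refl _ = ⊥-elim (<-irrefl refl φx<φy)
... | tri> _ _ y<x = ⊥-elim (<-asym φx<φy (mono y x y<x x<N))

strictMonoOn-bounded⇒≤ : ∀ s K g → StrictMonoOn s g → (∀ x → x < s → g x < K) → s ≤ K
strictMonoOn-bounded⇒≤ zero K g mono bound = z≤n
strictMonoOn-bounded⇒≤ (suc s) K g mono bound = ≤-trans (s≤s (strictMonoOn-id≤ mono s ≤-refl)) (bound s ≤-refl)

strictMonoOn-image⊆⇒≤ : ∀ s m ψ φ → StrictMonoOn s ψ → StrictMonoOn m φ →
  (∀ x → x < s → Σ ℕ λ y → y < m × φ y ≡ ψ x) → s ≤ m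
strictMonoOn-image⊆⇒≤ s m ψ φ monoψ monoφ image⊆ = strictMonoOn-bounded⇒≤ s m g mono-g (λ x x<s → proj₁ (g-spec x x<s))
  where
  g : ℕ → ℕ
  g x with x <? s
  ... | yes x<s = proj₁ (image⊆ x x<s)
  ... | no _ = 0
  g-spec : ∀ x → x < s → g x < m × φ (g x) ≡ ψ x
  g-spec x x<s with x <? s
  ... | yes x<s' = proj₂ (image⊆ x x<s')
  ... | no x≮s = ⊥-elim (x≮s x<s)
  mono-g : StrictMonoOn s g
  mono-g x y x<y y<s with <-cmp (g x) (g y) | g-spec x (<-trans x<y y<s) | g-spec y y<s
  ... | tri< gx<gy _ _ | _ | _ = gx<gy
  ... | tri≈ _ gx≡gy _ | (_ , φgx) | (_ , φgy) =
        ⊥-elim (<-irrefl (trans (sym φgx) (trans (cong φ gx≡gy) φgy)) (monoψ x y x<y y<s))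
  ... | tri> _ _ gy<gx | (gx<m , φgx) | (_ , φgy) =
        ⊥-elim (<-asym (monoψ x y x<y y<s) (subst₂ _<_ φgy φgx (monoφ _ _ gy<gx gx<m)))

strictMonoOn-below-or-top : ∀ m L τ → StrictMonoOn (suc m) τ → (∀ x → x ≤ m → τ x < m ⊎ τ x ≡ L) →
  (∀ x → x < m → τ x ≡ x) × τ m ≡ L
strictMonoOn-below-or-top m L τ mono below-or-top = τx≡x , τm≡L
  where
  τm≡L : τ m ≡ L
  τm≡L with below-or-top m ≤-refl
  ... | inj₁ τm<m = ⊥-elim (<-irrefl refl (<-≤-trans τm<m (strictMonoOn-id≤ mono m ≤-refl)))
  ... | inj₂ eq = eq
  τ<m : ∀ x → x < m → τ x < m
  τ<m x x<m with below-or-top x (<⇒≤ x<m)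
  ... | inj₁ lt = lt
  ... | inj₂ eq = ⊥-elim (<-irrefl (trans eq (sym τm≡L)) (mono x m x<m ≤-refl))
  τx≡x : ∀ x → x < m → τ x ≡ x
  τx≡x x x<m = ≤-antisym τx≤x (strictMonoOn-id≤ mono x (≤-trans x<m (n≤1+n m)))
    where
    k = m ∸ suc x
    x+k<m : suc (x + k) ≡ m
    x+k<m = m+[n∸m]≡n x<m
    τx≤x : τ x ≤ x
    τx≤x = +-cancelʳ-≤ k (τ x) x (≤-pred (≤-trans
             (s≤s (strictMonoOn-+ mono x k (s≤s (subst (x + k ≤_) x+k<m (n≤1+n _)))))
             (subst (τ (x + k) <_) (sym x+k<m) (τ<m (x + k) (subst (x + k <_) x+k<m ≤-refl)))))

≤-or-shifted : ∀ N x → x ≤ N ⊎ (Σ ℕ λ y → x ≡ N + y × 0 < y)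
≤-or-shifted N x with x ≤? N
... | yes x≤N = inj₁ x≤N
... | no x≰N = inj₂ (x ∸ N , sym (m+[n∸m]≡n N≤x) , m<n⇒0<n∸m (≰⇒> x≰N))
  where N≤x = <⇒≤ (≰⇒> x≰N)

preimage? : ∀ (ψ : ℕ → ℕ) (v N : ℕ) → (Σ ℕ λ x → x < N × ψ x ≡ v) ⊎ (∀ x → x < N → ψ x ≢ v)
preimage? ψ v zero = inj₂ (λ x ())
preimage? ψ v (suc N) with preimage? ψ v N | ψ N ≟ v
... | inj₁ (x , x<N , eq) | _ = inj₁ (x , ≤-trans x<N (n≤1+n N) , eq)
... | inj₂ _ | yes eq = inj₁ (N , ≤-refl , eq)
... | inj₂ none | no ψN≢v = inj₂ λ x x<1+N → [ none x , (λ { refl → ψN≢v }) ]′ (m≤n⇒m<n∨m≡n (≤-pred x<1+N))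

glue : ℕ → (ℕ → ℕ) → (ℕ → ℕ) → ℕ → ℕ
glue N φ₁ φ₂ x with x ≤? N
... | yes _ = φ₁ x
... | no _ = φ₂ (x ∸ N)

glue-≤ : ∀ N φ₁ φ₂ x → x ≤ N → glue N φ₁ φ₂ x ≡ φ₁ x
glue-≤ N φ₁ φ₂ x x≤N with x ≤? N
... | yes _ = refl
... | no x≰N = ⊥-elim (x≰N x≤N)

glue-+ : ∀ N φ₁ φ₂ y → φ₁ N ≡ φ₂ 0 → glue N φ₁ φ₂ (N + y) ≡ φ₂ y
glue-+ N φ₁ φ₂ zero agree rewrite +-identityʳ N = trans (glue-≤ N φ₁ φ₂ N ≤-refl) agree
glue-+ N φ₁ φ₂ (suc y) _ with (N + suc y) ≤? N
... | yes le = ⊥-elim (<-irrefl refl (≤-trans (m<m+n N z<s) le))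
... | no _ = cong φ₂ (m+n∸m≡n N (suc y))

-- Monochromatic copies

-- MonoCopy as a record: unlike the Σ-type MonoCopy unfolds to, a record type determines its parameters,
-- so they can be inferred from a copy.
record IsMonoCopy (col : Color) (G F : OGraph) (c : Coloring) (φ : ℕ → ℕ) : Set where
  constructor mono-copy
  field
    copy-bound : ∀ x → x < n G → φ x < n F
    copy-mono : StrictMonoOn (n G) φ
    copy-edge : ∀ x y → Edge G x y → Edge F (φ x) (φ y)
    copy-colour : ∀ x y → Edge G x y → c (φ x) (φ y) ≡ col
open IsMonoCopy public

HasCopy : Color → OGraph → OGraph → Coloring → Set
HasCopy col G F c = ∃ λ φ → IsMonoCopy col G F c φ

fromMonoCopy : ∀ {col G F c φ} → MonoCopy col G F c φ → IsMonoCopy col G F c φ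
fromMonoCopy ((bound , mono , edge) , colour) = mono-copy bound mono edge colour

toMonoCopy : ∀ {col G F c φ} → IsMonoCopy col G F c φ → MonoCopy col G F c φ
toMonoCopy (mono-copy bound mono edge colour) = (bound , mono , edge) , colour

¬HasCopy⇒¬HasMonoCopy : ∀ {col G F c} → ¬ HasCopy col G F c → ¬ HasMonoCopy col G F c
¬HasCopy⇒¬HasMonoCopy no-copy (φ , C) = no-copy (φ , fromMonoCopy C)

¬HasMonoCopy⇒¬HasCopy : ∀ {col G F c} → ¬ HasMonoCopy col G F c → ¬ HasCopy col G F c
¬HasMonoCopy⇒¬HasCopy no-copy (φ , C) = no-copy (φ , toMonoCopy C)

glue-copy : ∀ {col G G₁ G₂ N₁ N₂ F c φ₁ φ₂} → Split G G₁ G₂ N₁ N₂ →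
  IsMonoCopy col G₁ F c φ₁ → IsMonoCopy col G₂ F c φ₂ → φ₁ N₁ ≡ φ₂ 0 → IsMonoCopy col G F c (glue N₁ φ₁ φ₂)
glue-copy {col} {G} {G₁} {G₂} {N₁} {N₂} {F} {c} {φ₁} {φ₂} S
  (mono-copy bound₁ mono₁ edge₁ colour₁) (mono-copy bound₂ mono₂ edge₂ colour₂) agree =
  mono-copy bound mono (λ u v e → proj₁ (edge u v e)) (λ u v e → proj₂ (edge u v e))
  where
  open Split S
  φ = glue N₁ φ₁ φ₂
  ≤N₁⇒<n-left : ∀ {x} → x ≤ N₁ → x < n G₁
  ≤N₁⇒<n-left x≤N₁ = subst (_ <_) (sym n-left) (s≤s x≤N₁)
  shifted<n-right : ∀ {y} → N₁ + y < n G → y < n G₂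
  shifted<n-right {y} lt = subst (y <_) (sym n-right)
    (+-cancelˡ-< N₁ y (suc N₂) (subst (N₁ + y <_) (trans n-whole (sym (+-suc N₁ N₂))) lt))
  bound : ∀ x → x < n G → φ x < n F
  bound x lt with ≤-or-shifted N₁ x
  ... | inj₁ x≤ rewrite glue-≤ N₁ φ₁ φ₂ x x≤ = bound₁ x (≤N₁⇒<n-left x≤)
  ... | inj₂ (y , refl , _) rewrite glue-+ N₁ φ₁ φ₂ y agree = bound₂ y (shifted<n-right lt)
  mono : StrictMonoOn (n G) φ
  mono x y x<y y<n with ≤-or-shifted N₁ x | ≤-or-shifted N₁ y
  ... | inj₁ x≤ | inj₁ y≤ rewrite glue-≤ N₁ φ₁ φ₂ x x≤ | glue-≤ N₁ φ₁ φ₂ y y≤ =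
        mono₁ x y x<y (≤N₁⇒<n-left y≤)
  ... | inj₁ x≤ | inj₂ (y' , refl , 0<y') rewrite glue-≤ N₁ φ₁ φ₂ x x≤ | glue-+ N₁ φ₁ φ₂ y' agree =
        ≤-<-trans (subst (φ₁ x ≤_) agree (strictMonoOn⇒monoOn mono₁ x N₁ x≤ (≤N₁⇒<n-left ≤-refl)))
                  (mono₂ 0 y' 0<y' (shifted<n-right y<n))
  ... | inj₂ (x' , refl , _) | inj₁ y≤ = ⊥-elim (<-irrefl refl (≤-trans (<-≤-trans x<y y≤) (m≤m+n N₁ x')))
  ... | inj₂ (x' , refl , _) | inj₂ (y' , refl , _) rewrite glue-+ N₁ φ₁ φ₂ x' agree | glue-+ N₁ φ₁ φ₂ y' agree =
        mono₂ x' y' (+-cancelˡ-< N₁ x' y' x<y) (shifted<n-right y<n)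
  v≤N₁ : ∀ {u v} → Edge G₁ u v → v ≤ N₁
  v≤N₁ {u} {v} e = ≤-pred (subst (v <_) n-left (Edge⇒<n {G₁} e))
  edge : ∀ u v → Edge G u v → Edge F (φ u) (φ v) × c (φ u) (φ v) ≡ col
  edge u v e with edge-split u v e
  ... | inj₁ e₁ rewrite glue-≤ N₁ φ₁ φ₂ v (v≤N₁ e₁) | glue-≤ N₁ φ₁ φ₂ u (<⇒≤ (<-≤-trans (proj₁ e₁) (v≤N₁ e₁))) =
        edge₁ u v e₁ , colour₁ u v e₁
  ... | inj₂ (u' , v' , refl , refl , e₂) rewrite glue-+ N₁ φ₁ φ₂ u' agree | glue-+ N₁ φ₁ φ₂ v' agree =
        edge₂ u' v' e₂ , colour₂ u' v' e₂

copy-left : ∀ {col G G₁ G₂ N₁ N₂ F c φ} → Split G G₁ G₂ N₁ N₂ → IsMonoCopy col G F c φ → IsMonoCopy col G₁ F c φ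
copy-left {G = G} {G₁} {N₁ = N₁} {N₂} S C =
  mono-copy (λ x lt → copy-bound C x (lift lt)) (λ x y x<y y<n → copy-mono C x y x<y (lift y<n))
            (λ u v e → copy-edge C u v (edge-left u v e)) (λ u v e → copy-colour C u v (edge-left u v e))
  where
  open Split S
  lift : ∀ {x} → x < n G₁ → x < n G
  lift lt = subst (_ <_) (sym n-whole) (≤-trans (subst (_ <_) n-left lt) (s≤s (m≤m+n N₁ N₂)))

copy-right : ∀ {col G G₁ G₂ N₁ N₂ F c φ} → Split G G₁ G₂ N₁ N₂ → IsMonoCopy col G F c φ →
  IsMonoCopy col G₂ F c (λ y → φ (N₁ + y))
copy-right {G = G} {G₂ = G₂} {N₁} {N₂} S C =
  mono-copy (λ x lt → copy-bound C _ (lift lt)) (λ x y x<y y<n → copy-mono C _ _ (+-monoʳ-< N₁ x<y) (lift y<n))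
            (λ u v e → copy-edge C _ _ (edge-right u v e)) (λ u v e → copy-colour C _ _ (edge-right u v e))
  where
  open Split S
  lift : ∀ {x} → x < n G₂ → N₁ + x < n G
  lift {x} lt = subst (N₁ + x <_) (trans (+-suc N₁ N₂) (sym n-whole)) (+-monoʳ-< N₁ (subst (x <_) n-right lt))

copy-recolour : ∀ {col G F c₁ c₂ ψ} → IsMonoCopy col G F c₁ ψ →
  (∀ x y → x < n F → y < n F → c₁ x y ≡ c₂ x y) → IsMonoCopy col G F c₂ ψ
copy-recolour {G = G} (mono-copy bound mono edge colour) same = mono-copy bound mono edge λ x y e →
  trans (sym (same _ _ (bound x (Edge⇒source<n {G} e)) (bound y (Edge⇒<n {G} e)))) (colour x y e)

¬copy-into-smaller : ∀ {col G F c ψ} → n F < n G → ¬ IsMonoCopy col G F c ψ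
¬copy-into-smaller {G = G} {F} {ψ = ψ} lt C =
  <-irrefl refl (<-≤-trans lt (strictMonoOn-bounded⇒≤ (n G) (n F) ψ (copy-mono C) (copy-bound C)))

propagate : ∀ {G : OGraph} {ψ : ℕ → ℕ} (P : ℕ → Set) → LeftRooted G →
  (∀ x y → Edge G x y → P (ψ x) → P (ψ y)) → P (ψ 0) → ∀ x → x < n G → P (ψ x)
propagate {G} {ψ} P rooted step P₀ x = go x x ≤-refl
  where
  go : ∀ k x → x ≤ k → x < n G → P (ψ x)
  go zero .zero z≤n _ = P₀
  go (suc k) x x≤ x<n with m≤n⇒m<n∨m≡n x≤
  ... | inj₁ lt = go k x (≤-pred lt) x<n
  ... | inj₂ refl with rooted (suc k) z<s x<n
  ...   | (y , y<x , e) = step y (suc k) e (go k y (≤-pred y<x) (<-trans y<x x<n))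

propagate-back : ∀ {G : OGraph} {ψ : ℕ → ℕ} (P : ℕ → Set) → LeftRooted G →
  (∀ x y → Edge G x y → P (ψ y) → P (ψ x)) → ∀ x → x < n G → P (ψ x) → P (ψ 0)
propagate-back {G} {ψ} P rooted step x = go x x ≤-refl
  where
  go : ∀ k x → x ≤ k → x < n G → P (ψ x) → P (ψ 0)
  go k zero _ _ P₀ = P₀
  go zero (suc x) () _ _
  go (suc k) (suc x) x≤ x<n Px with rooted (suc x) z<s x<n
  ... | (y , y<x , e) = go k y (≤-trans (≤-pred y<x) (≤-pred x≤)) (<-trans y<x x<n) (step y (suc x) e Px)

-- A blue copy of a left-rooted (hence connected) graph that meets an isolated blue component stays inside it.
isolated-component-bound : ∀ {G G' F c Φ ψ} → LeftRooted G' → IsMonoCopy blue G F c Φ → InducedIsolatedBlue G F c Φ →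
  IsMonoCopy blue G' F c ψ → ∀ x₀ → x₀ < n G' → InCopy G Φ (ψ x₀) → n G' ≤ n G
isolated-component-bound {G} {G'} {F} {c} {Φ} {ψ} rooted CΦ (_ , isolated) Cψ x₀ x₀<n meets =
  strictMonoOn-image⊆⇒≤ (n G') (n G) ψ Φ (copy-mono Cψ) (copy-mono CΦ) inside
  where
  closed : ∀ x y → Edge G' x y → (InCopy G Φ (ψ x) → InCopy G Φ (ψ y)) × (InCopy G Φ (ψ y) → InCopy G Φ (ψ x))
  closed x y e = (λ i → proj₂ (isolated _ _ (copy-edge Cψ x y e) (copy-colour Cψ x y e) (inj₁ i))) ,
                 (λ i → proj₁ (isolated _ _ (copy-edge Cψ x y e) (copy-colour Cψ x y e) (inj₂ i)))
  inside : ∀ x → x < n G' → InCopy G Φ (ψ x)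
  inside = propagate (InCopy G Φ) rooted (λ x y e → proj₁ (closed x y e))
             (propagate-back (InCopy G Φ) rooted (λ x y e → proj₂ (closed x y e)) x₀ x₀<n meets)

InCopy-0 : ∀ {col G F c φ} → IsMonoCopy col G F c φ → InCopy G φ 0 → φ 0 ≡ 0
InCopy-0 C (zero , _ , φ₀≡0) = φ₀≡0
InCopy-0 {φ = φ} C (suc x , x<n , φx≡0) = ⊥-elim (n≮0 (subst (φ 0 <_) φx≡0 (copy-mono C 0 (suc x) z<s x<n)))

InCopy-last : ∀ {col G F c φ N} → n G ≡ suc N → 0 < n F → IsMonoCopy col G F c φ → InCopy G φ (n F ∸ 1) → φ N ≡ n F ∸ 1
InCopy-last {G = G} {F} {φ = φ} {N} n-G 0<n C (x , x<n , φx≡) with m≤n⇒m<n∨m≡n (≤-pred (subst (x <_) n-G x<n))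
... | inj₂ refl = φx≡
... | inj₁ x<N = ⊥-elim (<-irrefl refl (<-≤-trans (copy-bound C N N<n)
        (subst (_≤ φ N) (m∸n+n≡m 0<n) (subst (λ z → z + 1 ≤ φ N) φx≡ (subst (_≤ φ N) (+-comm 1 (φ x)) (copy-mono C x N x<N N<n))))))
  where N<n = subst (N <_) (sym n-G) ≤-refl

-- The hub construction

blockOffset : (ℕ → OGraph) → ℕ → ℕ
blockOffset g zero = 0
blockOffset g (suc t) = n (g 0) + blockOffset (λ t → g (suc t)) t

blockOffset-suc : ∀ g t → blockOffset g (suc t) ≡ blockOffset g t + n (g t)
blockOffset-suc g zero = +-comm (n (g 0)) 0
blockOffset-suc g (suc t) rewrite blockOffset-suc (λ t → g (suc t)) t = sym (+-assoc (n (g 0)) _ _)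

-- The block t < r and the position inside it of the w-th vertex of g 0, g 1, …, g (r - 1) laid side by side.
blockOf : (ℕ → OGraph) → ℕ → ℕ → Maybe (ℕ × ℕ)
blockOf g zero w = nothing
blockOf g (suc r) w with w <? n (g 0)
... | yes _ = just (0 , w)
... | no _ with blockOf (λ t → g (suc t)) r (w ∸ n (g 0))
...   | nothing = nothing
...   | just (t , x) = just (suc t , x)

blockOf-offset : ∀ g r t x → t < r → x < n (g t) → blockOf g r (blockOffset g t + x) ≡ just (t , x)
blockOf-offset g (suc r) zero x _ x<n with x <? n (g 0)
... | yes _ = refl
... | no x≮n = ⊥-elim (x≮n x<n)
blockOf-offset g (suc r) (suc t) x (s≤s t<r) x<n with (n (g 0) + blockOffset (λ t → g (suc t)) t + x) <? n (g 0)
... | yes lt = ⊥-elim (<-irrefl refl (<-≤-trans lt (≤-trans (m≤m+n (n (g 0)) _) (m≤m+n _ x))))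
... | no _ rewrite +-assoc (n (g 0)) (blockOffset (λ t → g (suc t)) t) x
                | m+n∸m≡n (n (g 0)) (blockOffset (λ t → g (suc t)) t + x)
                | blockOf-offset (λ t → g (suc t)) r t x t<r x<n = refl

blockOf-just : ∀ g r w t x → blockOf g r w ≡ just (t , x) → t < r × x < n (g t) × w ≡ blockOffset g t + x
blockOf-just g zero w t x ()
blockOf-just g (suc r) w t x eq with w <? n (g 0)
blockOf-just g (suc r) w .0 .w refl | yes w<n = z<s , w<n , refl
... | no w≮n with blockOf (λ t → g (suc t)) r (w ∸ n (g 0)) in eq'
blockOf-just g (suc r) w t x () | no w≮n | nothing
blockOf-just g (suc r) w .(suc t') .x' refl | no w≮n | just (t' , x')
  with blockOf-just (λ t → g (suc t)) r (w ∸ n (g 0)) t' x' eq'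
... | (t<r , x<n , w≡) = s≤s t<r , x<n ,
      trans (sym (m+[n∸m]≡n (≮⇒≥ w≮n))) (trans (cong (n (g 0) +_) w≡) (sym (+-assoc (n (g 0)) _ _)))

-- B followed by the blocks g 0, …, g (r - 1); the last vertex of B (the hub) is joined to the
-- first vertex of every block.
gadgetEdges : OGraph → (ℕ → OGraph) → ℕ → ℕ → ℕ → Bool
gadgetEdges B g r u v with v <? n B
... | yes _ = E B u v
... | no _ with blockOf g r (v ∸ n B)
...   | nothing = false
...   | just (t , y) with n B ≤? u
...     | no _ with u ≟ (n B ∸ 1) | y ≟ 0
...       | yes _ | yes _ = true
...       | _ | _ = false
gadgetEdges B g r u v | no _ | just (t , y) | yes _ with blockOf g r (u ∸ n B)
...       | nothing = false
...       | just (t' , x) with t ≟ t'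
...         | yes _ = E (g t) x y
...         | no _ = false

gadget : OGraph → (ℕ → OGraph) → ℕ → OGraph
gadget B g r = mkOGraph (n B + blockOffset g r) (gadgetEdges B g r)

-- Colour B by cB, the hub edge to block t by hubColour t, and the edges inside block t by blockColour t.
gadgetColouring : OGraph → (ℕ → OGraph) → ℕ → Coloring → (ℕ → Color) → (ℕ → Coloring) → Coloring
gadgetColouring B g r cB hubColour blockColour u v with v <? n B
... | yes _ = cB u v
... | no _ with blockOf g r (v ∸ n B)
...   | nothing = red
...   | just (t , y) with n B ≤? u
...     | no _ = hubColour t
...     | yes _ with blockOf g r (u ∸ n B)
...       | nothing = red
...       | just (t' , x) = blockColour t' x y

module Gadget (B : OGraph) (g : ℕ → OGraph) (r : ℕ) (B≢∅ : 0 < n B) (blocks≢∅ : ∀ t → 0 < n (g t)) where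
  F : OGraph
  F = gadget B g r

  hub : ℕ
  hub = n B ∸ 1

  start : ℕ → ℕ
  start t = n B + blockOffset g t

  suc-hub : suc hub ≡ n B
  suc-hub = trans (+-comm 1 hub) (m∸n+n≡m B≢∅)

  hub<nB : hub < n B
  hub<nB = subst (hub <_) suc-hub ≤-refl

  hub<nF : hub < n F
  hub<nF = ≤-trans hub<nB (m≤m+n _ _)

  start+0 : ∀ t → start t + 0 ≡ start t
  start+0 t = +-identityʳ (start t)

  start+ : ∀ t x → start t + x ≡ n B + (blockOffset g t + x)
  start+ t x = +-assoc (n B) (blockOffset g t) x

  nB≤start+ : ∀ t x → n B ≤ start t + x
  nB≤start+ t x = ≤-trans (m≤m+n (n B) (blockOffset g t)) (m≤m+n _ x)

  start+≮nB : ∀ t x → ¬ (start t + x < n B)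
  start+≮nB t x lt = <-irrefl refl (<-≤-trans lt (nB≤start+ t x))

  hub<start+ : ∀ t x → hub < start t + x
  hub<start+ t x = <-≤-trans hub<nB (nB≤start+ t x)

  blockOffset-< : ∀ t t' → t < t' → blockOffset g t + n (g t) ≤ blockOffset g t'
  blockOffset-< t (suc t') (s≤s t≤t') rewrite blockOffset-suc g t' with m≤n⇒m<n∨m≡n t≤t'
  ... | inj₁ lt = ≤-trans (blockOffset-< t t' lt) (m≤m+n _ _)
  ... | inj₂ refl = ≤-refl

  blockOffset-≤ : ∀ t t' → t ≤ t' → blockOffset g t ≤ blockOffset g t'
  blockOffset-≤ t t' le with m≤n⇒m<n∨m≡n le
  ... | inj₁ lt = ≤-trans (m≤m+n _ _) (blockOffset-< t t' lt)
  ... | inj₂ refl = ≤-refl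

  start-injective : ∀ t t' x x' → x < n (g t) → x' < n (g t') → start t + x ≡ start t' + x' → t ≡ t' × x ≡ x'
  start-injective t t' x x' x<n x'<n eq with <-cmp t t'
  ... | tri< lt _ _ = ⊥-elim (<-irrefl eq' (<-≤-trans (+-monoʳ-< (blockOffset g t) x<n)
                                            (≤-trans (blockOffset-< t t' lt) (m≤m+n _ _))))
    where eq' = +-cancelˡ-≡ (n B) _ _ (trans (sym (start+ t x)) (trans eq (start+ t' x')))
  ... | tri> _ _ gt = ⊥-elim (<-irrefl (sym eq') (<-≤-trans (+-monoʳ-< (blockOffset g t') x'<n)
                                                 (≤-trans (blockOffset-< t' t gt) (m≤m+n _ _))))
    where eq' = +-cancelˡ-≡ (n B) _ _ (trans (sym (start+ t x)) (trans eq (start+ t' x')))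
  ... | tri≈ _ refl _ = refl , +-cancelˡ-≡ (start t) x x' eq

  start-< : ∀ t t' → t < t' → start t < start t'
  start-< t t' lt = +-monoʳ-< (n B) (<-≤-trans (m<m+n (blockOffset g t) (blocks≢∅ t)) (blockOffset-< t t' lt))

  start-<⁻ : ∀ t t' → start t < start t' → t < t'
  start-<⁻ t t' lt with t <? t'
  ... | yes t<t' = t<t'
  ... | no t≮t' = ⊥-elim (<-irrefl refl (<-≤-trans lt (+-monoʳ-≤ (n B) (blockOffset-≤ t' t (≮⇒≥ t≮t')))))

  start+<n : ∀ t x → t < r → x < n (g t) → start t + x < n F
  start+<n t x t<r x<n = subst (_< n F) (sym (start+ t x))
    (+-monoʳ-< (n B) (<-≤-trans (+-monoʳ-< (blockOffset g t) x<n) (blockOffset-< t r t<r)))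

  start<n : ∀ t → t < r → start t < n F
  start<n t t<r = subst (_< n F) (start+0 t) (start+<n t 0 t<r (blocks≢∅ t))

  blockOf-start+ : ∀ t x → t < r → x < n (g t) → blockOf g r (start t + x ∸ n B) ≡ just (t , x)
  blockOf-start+ t x t<r x<n rewrite start+ t x | m+n∸m≡n (n B) (blockOffset g t + x) = blockOf-offset g r t x t<r x<n

  blockOf-start : ∀ t → t < r → blockOf g r (start t ∸ n B) ≡ just (t , 0)
  blockOf-start t t<r = subst (λ z → blockOf g r (z ∸ n B) ≡ just (t , 0)) (start+0 t)
                          (blockOf-start+ t 0 t<r (blocks≢∅ t))

  InBlock : ℕ → ℕ → Set
  InBlock t v = Σ ℕ λ x → x < n (g t) × v ≡ start t + x

  locateBlock : ∀ r' w → w < blockOffset g r' → Σ ℕ λ t → Σ ℕ λ x → t < r' × x < n (g t) × w ≡ blockOffset g t + x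
  locateBlock zero w ()
  locateBlock (suc r') w lt with w <? blockOffset g r'
  ... | yes w<o = let (t , x , t<r , x<n , eq) = locateBlock r' w w<o in t , x , ≤-trans t<r (n≤1+n r') , x<n , eq
  ... | no w≮o = r' , w ∸ blockOffset g r' , ≤-refl ,
        +-cancelˡ-< (blockOffset g r') _ _ (subst₂ _<_ (sym (m+[n∸m]≡n (≮⇒≥ w≮o))) (blockOffset-suc g r') lt) ,
        sym (m+[n∸m]≡n (≮⇒≥ w≮o))

  region : ∀ v → v < n F → v < n B ⊎ (Σ ℕ λ t → t < r × InBlock t v)
  region v lt with v <? n B
  ... | yes v<nB = inj₁ v<nB
  ... | no v≮nB with locateBlock r (v ∸ n B) (+-cancelˡ-< (n B) _ _ (subst (_< n F) (sym nB+[v∸nB]≡v) lt))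
    where nB+[v∸nB]≡v = m+[n∸m]≡n (≮⇒≥ v≮nB)
  ...   | (t , x , t<r , x<n , eq) = inj₂ (t , t<r , x , x<n ,
          trans (sym (m+[n∸m]≡n (≮⇒≥ v≮nB))) (trans (cong (n B +_) eq) (sym (start+ t x))))

  edge⁻ : ∀ u v → Edge F u v → Edge B u v ⊎ ((u ≡ hub × Σ ℕ λ t → t < r × v ≡ start t) ⊎
           (Σ ℕ λ t → Σ ℕ λ x → Σ ℕ λ y → t < r × u ≡ start t + x × v ≡ start t + y × Edge (g t) x y))
  edge⁻ u v (u<v , v<n , e) with v <? n B
  ... | yes v<nB = inj₁ (u<v , v<nB , e)
  ... | no v≮nB with blockOf g r (v ∸ n B) in v-in
  ...   | just (t , y) with n B ≤? u
  ...     | no _ with u ≟ hub | y ≟ 0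
  ...       | yes u≡hub | yes refl = inj₂ (inj₁ (u≡hub , t , t<r , trans v≡ (start+0 t)))
    where
    v-spec = blockOf-just g r (v ∸ n B) t 0 v-in
    t<r = proj₁ v-spec
    v≡ : v ≡ start t + 0
    v≡ = trans (sym (m+[n∸m]≡n (≮⇒≥ v≮nB))) (trans (cong (n B +_) (proj₂ (proj₂ v-spec))) (sym (start+ t 0)))
  edge⁻ u v (_ , _ , ()) | no _ | just _ | no _ | yes _ | no _
  edge⁻ u v (_ , _ , ()) | no _ | just _ | no _ | no _ | _
  edge⁻ u v (u<v , v<n , e) | no v≮nB | just (t , y) | yes nB≤u with blockOf g r (u ∸ n B) in u-in
  ... | just (t' , x) with t ≟ t'
  ...   | yes refl = inj₂ (inj₂ (t , x , y , proj₁ v-spec , u≡ , v≡ , x<y , proj₁ (proj₂ v-spec) , e))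
    where
    v-spec = blockOf-just g r (v ∸ n B) t y v-in
    u-spec = blockOf-just g r (u ∸ n B) t x u-in
    v≡ : v ≡ start t + y
    v≡ = trans (sym (m+[n∸m]≡n (≮⇒≥ v≮nB))) (trans (cong (n B +_) (proj₂ (proj₂ v-spec))) (sym (start+ t y)))
    u≡ : u ≡ start t + x
    u≡ = trans (sym (m+[n∸m]≡n nB≤u)) (trans (cong (n B +_) (proj₂ (proj₂ u-spec))) (sym (start+ t x)))
    x<y : x < y
    x<y = +-cancelˡ-< (start t) x y (subst₂ _<_ u≡ v≡ u<v)
  edge⁻ u v (_ , _ , ()) | no _ | just _ | yes _ | just _ | no _
  edge⁻ u v (_ , _ , ()) | no _ | just _ | yes _ | nothing
  edge⁻ u v (_ , _ , ()) | no _ | nothing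

  B-edge : ∀ u v → Edge B u v → Edge F u v
  B-edge u v (u<v , v<nB , e) with v <? n B
  ... | yes _ = u<v , ≤-trans v<nB (m≤m+n _ _) , e
  ... | no v≮nB = ⊥-elim (v≮nB v<nB)

  hub-edge : ∀ t → t < r → Edge F hub (start t)
  hub-edge t t<r with start t <? n B
  ... | yes lt = ⊥-elim (start+≮nB t 0 (subst (_< n B) (sym (start+0 t)) lt))
  ... | no _ with blockOf g r (start t ∸ n B) | blockOf-start t t<r
  ...   | .(just (t , 0)) | refl with n B ≤? hub
  ...     | yes le = ⊥-elim (<-irrefl refl (<-≤-trans hub<nB le))
  ...     | no _ with hub ≟ hub | 0 ≟ 0
  ...       | yes _ | yes _ = subst (hub <_) (start+0 t) (hub<start+ t 0) , start<n t t<r , refl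
  ...       | no hub≢hub | _ = ⊥-elim (hub≢hub refl)
  ...       | _ | no 0≢0 = ⊥-elim (0≢0 refl)

  block-edge : ∀ t x y → t < r → Edge (g t) x y → Edge F (start t + x) (start t + y)
  block-edge t x y t<r (x<y , y<n , e) with (start t + y) <? n B
  ... | yes lt = ⊥-elim (start+≮nB t y lt)
  ... | no _ with blockOf g r (start t + y ∸ n B) | blockOf-start+ t y t<r y<n
  ...   | .(just (t , y)) | refl with n B ≤? (start t + x)
  ...     | no nB≰ = ⊥-elim (nB≰ (nB≤start+ t x))
  ...     | yes _ with blockOf g r (start t + x ∸ n B) | blockOf-start+ t x t<r (<-trans x<y y<n)
  ...       | .(just (t , x)) | refl with t ≟ t
  ...         | yes refl = +-monoʳ-< (start t) x<y , start+<n t y t<r y<n , e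
  ...         | no t≢t = ⊥-elim (t≢t refl)

  module Colouring (cB : Coloring) (hubColour : ℕ → Color) (blockColour : ℕ → Coloring) where
    c : Coloring
    c = gadgetColouring B g r cB hubColour blockColour

    colour-B : ∀ u v → v < n B → c u v ≡ cB u v
    colour-B u v v<nB with v <? n B
    ... | yes _ = refl
    ... | no v≮nB = ⊥-elim (v≮nB v<nB)

    colour-hub : ∀ t → t < r → c hub (start t) ≡ hubColour t
    colour-hub t t<r with start t <? n B
    ... | yes lt = ⊥-elim (start+≮nB t 0 (subst (_< n B) (sym (start+0 t)) lt))
    ... | no _ with blockOf g r (start t ∸ n B) | blockOf-start t t<r
    ...   | .(just (t , 0)) | refl with n B ≤? hub
    ...     | yes le = ⊥-elim (<-irrefl refl (<-≤-trans hub<nB le))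
    ...     | no _ = refl

    colour-block : ∀ t x y → t < r → x < n (g t) → y < n (g t) → c (start t + x) (start t + y) ≡ blockColour t x y
    colour-block t x y t<r x<n y<n with (start t + y) <? n B
    ... | yes lt = ⊥-elim (start+≮nB t y lt)
    ... | no _ with blockOf g r (start t + y ∸ n B) | blockOf-start+ t y t<r y<n
    ...   | .(just (t , y)) | refl with n B ≤? (start t + x)
    ...     | no nB≰ = ⊥-elim (nB≰ (nB≤start+ t x))
    ...     | yes _ with blockOf g r (start t + x ∸ n B) | blockOf-start+ t x t<r x<n
    ...       | .(just (t , x)) | refl = refl

  blockColouring : Coloring → ℕ → Coloring
  blockColouring c t x y = c (start t + x) (start t + y)

  block-edge⁻ : ∀ t a b → a < n (g t) → Edge F (start t + a) (start t + b) → Edge (g t) a b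
  block-edge⁻ t a b a<n e with edge⁻ _ _ e
  ... | inj₁ eB = ⊥-elim (start+≮nB t b (Edge⇒<n {B} eB))
  ... | inj₂ (inj₁ (a≡hub , _)) = ⊥-elim (<-irrefl (sym a≡hub) (hub<start+ t a))
  ... | inj₂ (inj₂ (t' , a' , b' , _ , a≡ , b≡ , e'))
    with start-injective t t' a a' a<n (Edge⇒source<n {g t'} e') a≡
  ...   | refl , refl rewrite +-cancelˡ-≡ (start t) b b' b≡ = e'

  B-edge⁻ : ∀ u v → v < n B → Edge F u v → Edge B u v
  B-edge⁻ u v v<nB e with edge⁻ _ _ e
  ... | inj₁ eB = eB
  ... | inj₂ (inj₁ (_ , t , _ , refl)) = ⊥-elim (start+≮nB t 0 (subst (_< n B) (sym (start+0 t)) v<nB))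
  ... | inj₂ (inj₂ (t , _ , y , _ , _ , refl , _)) = ⊥-elim (start+≮nB t y v<nB)

  hub-neighbour : ∀ v → Edge F hub v → Σ ℕ λ t → t < r × v ≡ start t
  hub-neighbour v e with edge⁻ _ _ e
  ... | inj₁ (hub<v , v<nB , _) = ⊥-elim (<-irrefl refl (<-≤-trans hub<v (≤-pred (subst (v <_) (sym suc-hub) v<nB))))
  ... | inj₂ (inj₁ (_ , t , t<r , v≡)) = t , t<r , v≡
  ... | inj₂ (inj₂ (t , x , _ , _ , hub≡ , _ , _)) = ⊥-elim (<-irrefl hub≡ (hub<start+ t x))

  edge-into-start : ∀ u t → Edge F u (start t) → u ≡ hub
  edge-into-start u t e with edge⁻ _ _ e
  ... | inj₁ eB = ⊥-elim (start+≮nB t 0 (subst (_< n B) (sym (start+0 t)) (Edge⇒<n {B} eB)))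
  ... | inj₂ (inj₁ (u≡hub , _)) = u≡hub
  ... | inj₂ (inj₂ (t' , x , y , _ , _ , start≡ , e'))
    with start-injective t t' 0 y (blocks≢∅ t) (Edge⇒<n {g t'} e') (trans (start+0 t) start≡)
  ...   | refl , refl = ⊥-elim (n≮0 (proj₁ e'))

  B-edge-from : ∀ u v → u < n B → u ≢ hub → Edge F u v → v < n B
  B-edge-from u v u<nB u≢hub e with edge⁻ _ _ e
  ... | inj₁ eB = Edge⇒<n {B} eB
  ... | inj₂ (inj₁ (u≡hub , _)) = ⊥-elim (u≢hub u≡hub)
  ... | inj₂ (inj₂ (t , x , _ , _ , refl , _ , _)) = ⊥-elim (start+≮nB t x u<nB)

  InBlock-closed : ∀ t u v → Edge F u v → InBlock t u → InBlock t v
  InBlock-closed t u v e (x , x<n , refl) with edge⁻ _ _ e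
  ... | inj₁ eB = ⊥-elim (start+≮nB t x (Edge⇒source<n {B} eB))
  ... | inj₂ (inj₁ (u≡hub , _)) = ⊥-elim (<-irrefl (sym u≡hub) (hub<start+ t x))
  ... | inj₂ (inj₂ (t' , x' , y' , _ , u≡ , refl , e'))
    with start-injective t t' x x' x<n (Edge⇒source<n {g t'} e') u≡
  ...   | refl , refl = y' , Edge⇒<n {g t} e' , refl

  lift-from-block : ∀ {col G c ψ} t → t < r → IsMonoCopy col G (g t) (blockColouring c t) ψ →
    IsMonoCopy col G F c (λ x → start t + ψ x)
  lift-from-block t t<r (mono-copy bound mono edge colour) =
    mono-copy (λ x lt → start+<n t _ t<r (bound x lt)) (λ x y x<y y<n → +-monoʳ-< (start t) (mono x y x<y y<n))
              (λ x y e → block-edge t _ _ t<r (edge x y e)) colour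

  lift-from-B : ∀ {col G c ψ} → IsMonoCopy col G B c ψ → IsMonoCopy col G F c ψ
  lift-from-B (mono-copy bound mono edge colour) =
    mono-copy (λ x lt → ≤-trans (bound x lt) (m≤m+n _ _)) mono (λ x y e → B-edge _ _ (edge x y e)) colour

  copy-InBlock : ∀ {col G c ψ} t → LeftRooted G → IsMonoCopy col G F c ψ → InBlock t (ψ 0) →
    ∀ x → x < n G → InBlock t (ψ x)
  copy-InBlock t rooted C = propagate (InBlock t) rooted (λ x y e → InBlock-closed t _ _ (copy-edge C x y e))

  InBlock-start≤ : ∀ t v → InBlock t v → start t ≤ v
  InBlock-start≤ t v (x , _ , refl) = m≤m+n (start t) x

  InBlock-offset< : ∀ t v → InBlock t v → v ∸ start t < n (g t)
  InBlock-offset< t v (x , x<n , refl) = subst (_< n (g t)) (sym (m+n∸m≡n (start t) x)) x<n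

  restrict-to-block : ∀ {col G c ψ} t → t < r → LeftRooted G → IsMonoCopy col G F c ψ → InBlock t (ψ 0) →
    IsMonoCopy col G (g t) (blockColouring c t) (λ x → ψ x ∸ start t)
  restrict-to-block {col} {G} {c} {ψ} t t<r rooted C ψ₀∈t =
    mono-copy bound
      (λ x y x<y y<n → ∸-monoˡ-< (copy-mono C x y x<y y<n) (start≤ x (<-trans x<y y<n)))
      (λ x y e → block-edge⁻ t _ _ (bound x (Edge⇒source<n {G} e))
                   (subst₂ (Edge F) (split x (Edge⇒source<n {G} e)) (split y (Edge⇒<n {G} e)) (copy-edge C x y e)))
      (λ x y e → subst₂ (λ a b → c a b ≡ col) (split x (Edge⇒source<n {G} e)) (split y (Edge⇒<n {G} e)) (copy-colour C x y e))
    where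
    inside = copy-InBlock t rooted C ψ₀∈t
    start≤ : ∀ x → x < n G → start t ≤ ψ x
    start≤ x lt = InBlock-start≤ t (ψ x) (inside x lt)
    split : ∀ x → x < n G → ψ x ≡ start t + (ψ x ∸ start t)
    split x lt = sym (m+[n∸m]≡n (start≤ x lt))
    bound : ∀ x → x < n G → ψ x ∸ start t < n (g t)
    bound x lt = InBlock-offset< t (ψ x) (inside x lt)

  restrict-to-B : ∀ {col G c ψ} → IsMonoCopy col G F c ψ → (∀ x → x < n G → ψ x < n B) → IsMonoCopy col G B c ψ
  restrict-to-B {G = G} (mono-copy _ mono edge colour) inB =
    mono-copy inB mono (λ x y e → B-edge⁻ _ _ (inB y (Edge⇒<n {G} e)) (edge x y e)) colour

  stays-in-B : ∀ {col G c ψ} → LeftRooted G → IsMonoCopy col G F c ψ → (∀ x y → Edge G x y → ψ x ≢ hub) →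
    ψ 0 < n B → ∀ x → x < n G → ψ x < n B
  stays-in-B {ψ = ψ} rooted C avoids-hub =
    propagate (_< n B) rooted (λ x y e ψx<nB → B-edge-from _ _ ψx<nB (avoids-hub x y e) (copy-edge C x y e))

  hubStar : (ℕ → ℕ) → ℕ → ℕ
  hubStar τ zero = hub
  hubStar τ (suc x) = start (τ x)

  hubStar-copy : ∀ col q τ c → StrictMonoOn q τ → (∀ x → x < q → τ x < r) →
    (∀ x → x < q → c hub (start (τ x)) ≡ col) → IsMonoCopy col (rightStar q) F c (hubStar τ)
  hubStar-copy col q τ c mono τ<r coloured = mono-copy bound mono' edge colour
    where
    bound : ∀ x → x < suc q → hubStar τ x < n F
    bound zero _ = hub<nF
    bound (suc x) (s≤s lt) = start<n (τ x) (τ<r x lt)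
    mono' : StrictMonoOn (suc q) (hubStar τ)
    mono' zero (suc y) _ _ = subst (hub <_) (start+0 (τ y)) (hub<start+ (τ y) 0)
    mono' (suc x) (suc y) (s≤s x<y) (s≤s y<q) = start-< _ _ (mono x y x<y y<q)
    edge : ∀ u v → Edge (rightStar q) u v → Edge F (hubStar τ u) (hubStar τ v)
    edge u v e with rightStar-edge⁻ q u v e
    ... | refl , v' , refl , v'<q = hub-edge (τ v') (τ<r v' v'<q)
    colour : ∀ u v → Edge (rightStar q) u v → c (hubStar τ u) (hubStar τ v) ≡ col
    colour u v e with rightStar-edge⁻ q u v e
    ... | refl , v' , refl , v'<q = coloured v' v'<q

  hubStar-decomposition : ∀ {col q c ψ} → IsMonoCopy col (rightStar q) F c ψ → ψ 0 ≡ hub →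
    Σ (ℕ → ℕ) λ τ → StrictMonoOn q τ × (∀ x → x < q → τ x < r) × (∀ x → x < q → ψ (suc x) ≡ start (τ x))
  hubStar-decomposition {col} {q} {c} {ψ} (mono-copy _ mono edge _) ψ₀≡hub = τ , mono-τ , τ<r , ψ≡
    where
    leaf : ∀ x → x < q → Σ ℕ λ t → t < r × ψ (suc x) ≡ start t
    leaf x lt = hub-neighbour (ψ (suc x)) (subst (λ z → Edge F z (ψ (suc x))) ψ₀≡hub (edge 0 (suc x) (rightStar-edge q x lt)))
    τ : ℕ → ℕ
    τ x with x <? q
    ... | yes lt = proj₁ (leaf x lt)
    ... | no _ = 0
    τ-spec : ∀ x → x < q → τ x < r × ψ (suc x) ≡ start (τ x)
    τ-spec x lt with x <? q
    ... | yes lt' = proj₂ (leaf x lt')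
    ... | no x≮q = ⊥-elim (x≮q lt)
    τ<r : ∀ x → x < q → τ x < r
    τ<r x lt = proj₁ (τ-spec x lt)
    ψ≡ : ∀ x → x < q → ψ (suc x) ≡ start (τ x)
    ψ≡ x lt = proj₂ (τ-spec x lt)
    mono-τ : StrictMonoOn q τ
    mono-τ x y x<y y<q = start-<⁻ _ _ (subst₂ _<_ (ψ≡ x (<-trans x<y y<q)) (ψ≡ y y<q) (mono (suc x) (suc y) (s≤s x<y) (s≤s y<q)))

-- Counting hub colours

_≟ᶜ_ : (a b : Color) → Dec (a ≡ b)
red ≟ᶜ red = yes refl
red ≟ᶜ blue = no (λ ())
blue ≟ᶜ red = no (λ ())
blue ≟ᶜ blue = yes refl

≢blue⇒≡red : ∀ {a} → a ≢ blue → a ≡ red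
≢blue⇒≡red {red} _ = refl
≢blue⇒≡red {blue} a≢blue = ⊥-elim (a≢blue refl)

count : Color → (ℕ → Color) → ℕ → ℕ
count col f zero = 0
count col f (suc K) with f K ≟ᶜ col
... | yes _ = suc (count col f K)
... | no _ = count col f K

count-red+count-blue : ∀ f K → count red f K + count blue f K ≡ K
count-red+count-blue f zero = refl
count-red+count-blue f (suc K) with f K ≟ᶜ red | f K ≟ᶜ blue
... | yes _ | no _ = cong suc (count-red+count-blue f K)
... | no _ | yes _ = trans (+-suc _ _) (cong suc (count-red+count-blue f K))
... | yes ≡red | yes ≡blue with () ← trans (sym ≡red) ≡blue
... | no ≢red | no ≢blue = ⊥-elim (≢red (≢blue⇒≡red ≢blue))

count-≤-suc : ∀ col f K → count col f K ≤ count col f (suc K)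
count-≤-suc col f K with f K ≟ᶜ col
... | yes _ = n≤1+n _
... | no _ = ≤-refl

count-suc-≡ : ∀ col f K → f K ≡ col → count col f (suc K) ≡ suc (count col f K)
count-suc-≡ col f K fK≡col with f K ≟ᶜ col
... | yes _ = refl
... | no fK≢col = ⊥-elim (fK≢col fK≡col)

-- Pigeonhole for two colours, with both sides moved so that no subtraction occurs.
few-red⇒many-blue : ∀ a b k s → a + b ≡ k + s → a ≤ s → k ≤ b
few-red⇒many-blue a b k s a+b≡k+s a≤s = +-cancelʳ-≤ s k b
  (subst (_≤ b + s) a+b≡k+s (≤-trans (+-monoˡ-≤ b a≤s) (≤-reflexive (+-comm s b))))

extendLast : ℕ → (ℕ → ℕ) → ℕ → ℕ → ℕ
extendLast s τ L x with x <? s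
... | yes _ = τ x
... | no _ = L

extendLast-< : ∀ s τ L x → x < s → extendLast s τ L x ≡ τ x
extendLast-< s τ L x x<s with x <? s
... | yes _ = refl
... | no x≮s = ⊥-elim (x≮s x<s)

extendLast-≡ : ∀ s τ L → extendLast s τ L s ≡ L
extendLast-≡ s τ L with s <? s
... | yes lt = ⊥-elim (<-irrefl refl lt)
... | no _ = refl

extendLast-all : ∀ (P : ℕ → Set) s τ L → (∀ x → x < s → P (τ x)) → P L → ∀ x → x < suc s → P (extendLast s τ L x)
extendLast-all P s τ L Pτ PL x _ with x <? s
... | yes x<s = Pτ x x<s
... | no _ = PL

extendLast-mono : ∀ s τ L → StrictMonoOn s τ → (∀ x → x < s → τ x < L) → StrictMonoOn (suc s) (extendLast s τ L)
extendLast-mono s τ L mono τ<L x y x<y y<1+s with x <? s | y <? s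
... | yes _ | yes y<s = mono x y x<y y<s
... | yes x<s | no _ = τ<L x x<s
... | no x≮s | _ = ⊥-elim (x≮s (<-≤-trans x<y (≤-pred y<1+s)))

select : ∀ col f K s → s ≤ count col f K →
  Σ (ℕ → ℕ) λ τ → StrictMonoOn s τ × (∀ x → x < s → τ x < K) × (∀ x → x < s → f (τ x) ≡ col)
select col f K zero _ = (λ _ → 0) , (λ x y x<y ()) , (λ x ()) , (λ x ())
select col f zero (suc s) ()
select col f (suc K) (suc s) s≤count with f K ≟ᶜ col
... | no _ with select col f K (suc s) s≤count
...   | (τ , mono , τ<K , coloured) = τ , mono , (λ x lt → ≤-trans (τ<K x lt) (n≤1+n K)) , coloured
select col f (suc K) (suc s) (s≤s s≤count) | yes fK≡col with select col f K s s≤count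
... | (τ , mono , τ<K , coloured) =
      extendLast s τ K , extendLast-mono s τ K mono τ<K ,
      extendLast-all (_< suc K) s τ K (λ x x<s → ≤-trans (τ<K x x<s) (n≤1+n K)) ≤-refl ,
      extendLast-all (λ t → f t ≡ col) s τ K coloured fK≡col

-- Determiners

Forcing : ℕ → OGraph → OGraph → Set
Forcing q G X = ∀ c → ¬ HasCopy red (rightStar q) X c → Σ (ℕ → ℕ) λ φ → IsMonoCopy blue G X c φ × φ 0 ≡ 0

-- Blocks 0 … m - 1 are single vertices, blocks m … m + p' - 1 copies of L, and the last block (m + p') is T.
module StarGadget (p' : ℕ) (B : OGraph) (B≢∅ : 0 < n B) (m : ℕ) (L T : OGraph) (L≢∅ : 0 < n L) (T≢∅ : 0 < n T) where
  p : ℕ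
  p = suc p'

  last : ℕ
  last = m + p'

  r : ℕ
  r = suc last

  block : ℕ → OGraph
  block t with t <? m
  ... | yes _ = point
  ... | no _ with t <? last
  ...   | yes _ = L
  ...   | no _ = T

  block≢∅ : ∀ t → 0 < n (block t)
  block≢∅ t with t <? m
  ... | yes _ = z<s
  ... | no _ with t <? last
  ...   | yes _ = L≢∅
  ...   | no _ = T≢∅

  open Gadget B block r B≢∅ block≢∅ public

  data BlockKind (t : ℕ) : Set where
    point-block : t < m → BlockKind t
    L-block : m ≤ t → t < last → BlockKind t
    last-block : t ≡ last → BlockKind t

  blockKind : ∀ t → t < r → BlockKind t
  blockKind t t<r with t <? m
  ... | yes t<m = point-block t<m
  ... | no t≮m with t <? last
  ...   | yes t<last = L-block (≮⇒≥ t≮m) t<last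
  ...   | no t≮last = last-block (≤-antisym (≤-pred t<r) (≮⇒≥ t≮last))

  block-point : ∀ t → t < m → block t ≡ point
  block-point t t<m with t <? m
  ... | yes _ = refl
  ... | no t≮m = ⊥-elim (t≮m t<m)

  block-L : ∀ t → m ≤ t → t < last → block t ≡ L
  block-L t m≤t t<last with t <? m
  ... | yes t<m = ⊥-elim (<-irrefl refl (<-≤-trans t<m m≤t))
  ... | no _ with t <? last
  ...   | yes _ = refl
  ...   | no t≮last = ⊥-elim (t≮last t<last)

  block-last : block last ≡ T
  block-last with last <? m
  ... | yes last<m = ⊥-elim (<-irrefl refl (<-≤-trans last<m (m≤m+n m p')))
  ... | no _ with last <? last
  ...   | yes lt = ⊥-elim (<-irrefl refl lt)
  ...   | no _ = refl

  hubColour : ℕ → Color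
  hubColour t with t <? m
  ... | yes _ = blue
  ... | no _ with t <? last
  ...   | yes _ = red
  ...   | no _ = blue

  hubColour-point : ∀ t → t < m → hubColour t ≡ blue
  hubColour-point t t<m with t <? m
  ... | yes _ = refl
  ... | no t≮m = ⊥-elim (t≮m t<m)

  hubColour-last : hubColour last ≡ blue
  hubColour-last with last <? m
  ... | yes _ = refl
  ... | no _ with last <? last
  ...   | yes lt = ⊥-elim (<-irrefl refl lt)
  ...   | no _ = refl

  hubColour-blue⁻ : ∀ t → t < r → hubColour t ≡ blue → t < m ⊎ t ≡ last
  hubColour-blue⁻ t t<r _ with t <? m
  ... | yes t<m = inj₁ t<m
  ... | no _ with t <? last
  hubColour-blue⁻ t t<r () | no _ | yes _
  ... | no t≮last = inj₂ (≤-antisym (≤-pred t<r) (≮⇒≥ t≮last))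

  hubColour-red⁻ : ∀ t → hubColour t ≡ red → m ≤ t × t < last
  hubColour-red⁻ t _ with t <? m
  hubColour-red⁻ t () | yes _
  ... | no t≮m with t <? last
  ...   | yes t<last = ≮⇒≥ t≮m , t<last
  hubColour-red⁻ t () | no _ | no _

  lift-from-block-of : ∀ {col G X c ψ} t → t < r → block t ≡ X → IsMonoCopy col G X (blockColouring c t) ψ →
    IsMonoCopy col G F c (λ x → start t + ψ x)
  lift-from-block-of t t<r refl = lift-from-block t t<r

  red-hub-edges<p : ∀ c → ¬ HasCopy red (rightStar p) F c → ∀ K → K ≤ r → count red (λ t → c hub (start t)) K < p
  red-hub-edges<p c no-red K K≤r with p ≤? count red (λ t → c hub (start t)) K
  ... | no p≰ = ≰⇒> p≰
  ... | yes p≤ with select red (λ t → c hub (start t)) K p p≤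
  ...   | (τ , mono , τ<K , coloured) =
          ⊥-elim (no-red (hubStar τ , hubStar-copy red p τ c mono (λ x lt → <-≤-trans (τ<K x lt) K≤r) coloured))

  forced-in-block : ∀ {G c} t → t < r → block t ≡ L → Forcing p G L → ¬ HasCopy red (rightStar p) F c →
    Σ (ℕ → ℕ) λ φ → IsMonoCopy blue G F c φ × φ 0 ≡ start t
  forced-in-block {G} {c} t t<r block≡L forcing no-red =
    (λ x → start t + φ x) , lift-from-block-of t t<r block≡L C , trans (cong (start t +_) φ₀≡0) (start+0 t)
    where
    no-red-in-block : ¬ HasCopy red (rightStar p) L (blockColouring c t)
    no-red-in-block (ψ , R) = no-red (_ , lift-from-block-of t t<r block≡L R)
    forced = forcing (blockColouring c t) no-red-in-block
    φ = proj₁ forced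
    C = proj₁ (proj₂ forced)
    φ₀≡0 = proj₂ (proj₂ forced)

  point-block-no-edge : ∀ t v → block t ≡ point → ¬ Edge F (start t) v
  point-block-no-edge t v block≡point e with edge⁻ _ _ e
  ... | inj₁ eB = start+≮nB t 0 (subst (_< n B) (sym (start+0 t)) (Edge⇒source<n {B} eB))
  ... | inj₂ (inj₁ (start≡hub , _)) = <-irrefl (sym start≡hub) (subst (hub <_) (start+0 t) (hub<start+ t 0))
  ... | inj₂ (inj₂ (t' , x , y , _ , start≡ , _ , e'))
    with start-injective t t' 0 x (block≢∅ t) (Edge⇒source<n {block t'} e') (trans (start+0 t) start≡)
  ...   | refl , refl = point-edgeless 0 y (subst (λ X → Edge X 0 y) block≡point e')

  star-to-last : ∀ c τ → StrictMonoOn m τ → (∀ x → x < m → τ x < last) → (∀ x → x < m → c hub (start (τ x)) ≡ blue) →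
    c hub (start last) ≡ blue → IsMonoCopy blue (rightStar (suc m)) F c (hubStar (extendLast m τ last))
  star-to-last c τ mono τ<last blue-edges blue-last =
    hubStar-copy blue (suc m) (extendLast m τ last) c (extendLast-mono m τ last mono τ<last)
      (extendLast-all (_< r) m τ last (λ x lt → ≤-trans (τ<last x lt) (n≤1+n last)) ≤-refl)
      (extendLast-all (λ t → c hub (start t) ≡ blue) m τ last blue-edges blue-last)

  module Colouring⋆ (cB cL cT : Coloring) where
    blockColour : ℕ → Coloring
    blockColour t with t <? last
    ... | yes _ = cL
    ... | no _ = cT

    blockColour-L : ∀ t → t < last → blockColour t ≡ cL
    blockColour-L t t<last with t <? last
    ... | yes _ = refl
    ... | no t≮last = ⊥-elim (t≮last t<last)

    blockColour-last : blockColour last ≡ cT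
    blockColour-last with last <? last
    ... | yes lt = ⊥-elim (<-irrefl refl lt)
    ... | no _ = refl

    open Colouring cB hubColour blockColour public

    colour-last : ∀ a b → a < n T → b < n T → c (start last + a) (start last + b) ≡ cT a b
    colour-last a b a<n b<n = trans (colour-block last a b ≤-refl (subst (a <_) (cong n (sym block-last)) a<n)
                                                        (subst (b <_) (cong n (sym block-last)) b<n))
                                    (cong (λ c → c a b) blockColour-last)

    lift-from-last : ∀ {col G ψ} → IsMonoCopy col G T cT ψ → IsMonoCopy col G F c (λ x → start last + ψ x)
    lift-from-last C = lift-from-block-of last ≤-refl block-last
      (copy-recolour C (λ a b a<n b<n → sym (colour-last a b a<n b<n)))

    restrict-to-last : ∀ {col G ψ} → LeftRooted G → IsMonoCopy col G F c ψ → InBlock last (ψ 0) →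
      IsMonoCopy col G T cT (λ x → ψ x ∸ start last)
    restrict-to-last {col} {G} {ψ} rooted C ψ₀∈last = copy-recolour
      (subst (λ X → IsMonoCopy col G X (blockColouring c last) (λ x → ψ x ∸ start last)) block-last (restrict-to-block last ≤-refl rooted C ψ₀∈last))
      colour-last

    -- A copy of a left-rooted graph with an edge cannot start inside a single-vertex block.
    copy-in-block : ∀ {col G ψ} t → t < r → 1 < n G → LeftRooted G → IsMonoCopy col G F c ψ → InBlock t (ψ 0) →
      HasCopy col G L cL ⊎ (t ≡ last × HasCopy col G T cT)
    copy-in-block {col} {G} {ψ} t t<r 1<n rooted C ψ₀∈t with blockKind t t<r
    ... | point-block t<m = ⊥-elim (¬copy-into-smaller 1<n
            (subst (λ X → IsMonoCopy col G X (blockColouring c t) (λ x → ψ x ∸ start t)) (block-point t t<m) (restrict-to-block t t<r rooted C ψ₀∈t)))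
    ... | L-block m≤t t<last = inj₁ (_ , copy-recolour
            (subst (λ X → IsMonoCopy col G X (blockColouring c t) (λ x → ψ x ∸ start t)) (block-L t m≤t t<last) (restrict-to-block t t<r rooted C ψ₀∈t))
            (λ a b a<n b<n → trans (colour-block t a b t<r (subst (a <_) (cong n (sym (block-L t m≤t t<last))) a<n)
                                                          (subst (b <_) (cong n (sym (block-L t m≤t t<last))) b<n))
                                   (cong (λ c → c a b) (blockColour-L t t<last))))
    ... | last-block refl = inj₂ (refl , _ , restrict-to-last rooted C ψ₀∈t)

    no-red-star : ¬ HasCopy red (rightStar p) B cB → ¬ HasCopy red (rightStar p) L cL →
      ¬ HasCopy red (rightStar p) T cT → ¬ HasCopy red (rightStar p) F c
    no-red-star no-red-B no-red-L no-red-T (ψ , C) with region (ψ 0) (copy-bound C 0 z<s)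
    ... | inj₂ (t , t<r , ψ₀∈t) =
          [ no-red-L , (λ (_ , R) → no-red-T R) ]′ (copy-in-block t t<r (s≤s (s≤s z≤n)) (rightStar-leftRooted p) C ψ₀∈t)
    ... | inj₁ ψ₀<nB with ψ 0 ≟ hub
    ...   | no ψ₀≢hub = no-red-B (ψ , copy-recolour
            (restrict-to-B C (stays-in-B (rightStar-leftRooted p) C centre-avoids-hub ψ₀<nB))
            (λ x y _ y<n → colour-B x y y<n))
      where
      centre-avoids-hub : ∀ x y → Edge (rightStar p) x y → ψ x ≢ hub
      centre-avoids-hub x y e with rightStar-edge⁻ p x y e
      ... | refl , _ = ψ₀≢hub
    ...   | yes ψ₀≡hub = <-irrefl refl (strictMonoOn-bounded⇒≤ p p' (λ x → τ x ∸ m) mono' bounded)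
      where
      decomposition = hubStar-decomposition C ψ₀≡hub
      τ = proj₁ decomposition
      τ-mono = proj₁ (proj₂ decomposition)
      τ<r = proj₁ (proj₂ (proj₂ decomposition))
      ψ≡ = proj₂ (proj₂ (proj₂ decomposition))
      into-L : ∀ x → x < p → m ≤ τ x × τ x < last
      into-L x lt = hubColour-red⁻ (τ x) (trans (sym (colour-hub (τ x) (τ<r x lt)))
                      (subst₂ (λ a b → c a b ≡ red) ψ₀≡hub (ψ≡ x lt) (copy-colour C 0 (suc x) (rightStar-edge p x lt))))
      mono' : StrictMonoOn p (λ x → τ x ∸ m)
      mono' x y x<y y<p = ∸-monoˡ-< (τ-mono x y x<y y<p) (proj₁ (into-L x (<-trans x<y y<p)))
      bounded : ∀ x → x < p → τ x ∸ m < p'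
      bounded x lt = +-cancelˡ-< m _ _ (subst (_< m + p') (sym (m+[n∸m]≡n (proj₁ (into-L x lt)))) (proj₂ (into-L x lt)))

    pointsAndLast : ℕ → ℕ
    pointsAndLast = extendLast m (λ x → x) last

    designed-star : IsMonoCopy blue (rightStar (suc m)) F c (hubStar pointsAndLast)
    designed-star = star-to-last c (λ x → x) (λ x y x<y _ → x<y) (λ x x<m → ≤-trans x<m (m≤m+n m p'))
      (λ x x<m → trans (colour-hub x (≤-trans x<m (≤-trans (m≤m+n m p') (n≤1+n last)))) (hubColour-point x x<m))
      (trans (colour-hub last ≤-refl) hubColour-last)

point-copy : ∀ col c → IsMonoCopy col point point c (λ _ → 0)
point-copy col c = mono-copy (λ _ _ → z<s) (λ { x y x<y (s≤s z≤n) → ⊥-elim (n≮0 x<y) })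
                             (λ x y e → ⊥-elim (point-edgeless x y e)) (λ x y e → ⊥-elim (point-edgeless x y e))

point-isolated : ∀ c → InducedIsolatedBlue point point c (λ _ → 0)
point-isolated c = (λ x y _ _ e _ → ⊥-elim (point-edgeless _ _ e)) , (λ u v e _ _ → ⊥-elim (point-edgeless _ _ e))

point-same : ∀ φ ψ → φ 0 ≡ ψ 0 → SameCopy point φ ψ
point-same φ ψ eq zero _ = eq
point-same φ ψ eq (suc x) (s≤s ())

module Determiners (p' : ℕ) (d : ℕ → ℕ) (d≥1 : ∀ k → 1 ≤ k → 1 ≤ d k) where
  p : ℕ
  p = suc p'

  H : ℕ → OGraph
  H = Hseg d 1

  NoRedStar : OGraph → Coloring → Set
  NoRedStar F c = ¬ HasCopy red (rightStar p) F c

  Hseg-last-< : ∀ k k' → k < k' → Hseg-last d 1 k < Hseg-last d 1 k'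
  Hseg-last-< k (suc k') (s≤s k≤k') with m≤n⇒m<n∨m≡n k≤k'
  ... | inj₁ lt = <-≤-trans (Hseg-last-< k k' lt) (m≤n+m _ _)
  ... | inj₂ refl = m<n+m (Hseg-last d 1 k) (d≥1 (suc k) (s≤s z≤n))

  d≡suc : ∀ k → 1 ≤ k → d k ≡ suc (d k ∸ 1)
  d≡suc k k≥1 with d k | d≥1 k k≥1
  ... | suc _ | _ = refl

  0<n-Hseg : ∀ j k → 0 < n (Hseg d j k)
  0<n-Hseg j k = subst (0 <_) (sym (n-Hseg d j k)) z<s

  1<n-H : ∀ k → 1 ≤ k → 1 < n (H k)
  1<n-H k k≥1 = subst (1 <_) (sym (n-Hseg d 1 k)) (s≤s (Hseg-last-< 0 k k≥1))

  no-red-in-point : ∀ c → NoRedStar point c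
  no-red-in-point c (_ , C) = ¬copy-into-smaller (s≤s (s≤s z≤n)) C

  -- A left determiner with the copy at vertex 0 and with no blue H k for any larger k,
  -- the form in which the construction can be iterated.
  record StrongLeftDeterminer (i : ℕ) (F : OGraph) : Set where
    field
      nonempty : 0 < n F
      forced : Forcing p (H i) F
      colouring : Coloring
      no-red : NoRedStar F colouring
      no-blue-above : ∀ k → i < k → ¬ HasCopy blue (H k) F colouring
      copy : ℕ → ℕ
      copy-blue : IsMonoCopy blue (H i) F colouring copy
      copy-0 : copy 0 ≡ 0
      copy-unique : ∀ ψ → IsMonoCopy blue (H i) F colouring ψ → ψ 0 ≡ 0 → SameCopy (H i) copy ψ
      copy-isolated : InducedIsolatedBlue (H i) F colouring copy

  point-strongLeftDeterminer : StrongLeftDeterminer 0 point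
  point-strongLeftDeterminer = record
    { nonempty = z<s
    ; forced = λ c _ → (λ _ → 0) , point-copy blue c , refl
    ; colouring = λ _ _ → blue
    ; no-red = no-red-in-point _
    ; no-blue-above = λ k 0<k (_ , C) → ¬copy-into-smaller (1<n-H k 0<k) C
    ; copy = λ _ → 0
    ; copy-blue = point-copy blue _
    ; copy-0 = refl
    ; copy-unique = λ ψ _ ψ₀≡0 → point-same _ ψ (sym ψ₀≡0)
    ; copy-isolated = point-isolated _
    }

  module LeftStep (i : ℕ) (L : OGraph) (ld : StrongLeftDeterminer i L) (m : ℕ) (d≡ : d (suc i) ≡ suc m) where
    open StrongLeftDeterminer ld using () renaming
      (nonempty to L≢∅; forced to L-forced; colouring to cL; no-red to L-no-red; no-blue-above to L-no-blue-above;
       copy to φL; copy-blue to φL-blue; copy-0 to φL-0; copy-unique to φL-unique; copy-isolated to φL-isolated)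
    open StarGadget p' point z<s m L L L≢∅ L≢∅ hiding (p)

    S : Split (H (suc i)) (rightStar (suc m)) (H i) (suc m) (Hseg-last d 1 i)
    S = Hseg-split-firstStar d 1 i m d≡

    block-from-m : ∀ t → m ≤ t → t < r → block t ≡ L
    block-from-m t m≤t t<r with blockKind t t<r
    ... | point-block t<m = ⊥-elim (<-irrefl refl (<-≤-trans t<m m≤t))
    ... | L-block _ t<last = block-L t m≤t t<last
    ... | last-block refl = block-last

    F-forced : Forcing p (H (suc i)) F
    F-forced c no-red = glue (suc m) (hubStar τ) φ₂ , glue-copy S star C₂ (sym φ₂-0) , refl
      where
      hubColours = λ t → c hub (start t)
      enough-blue : suc m ≤ count blue hubColours r
      enough-blue = few-red⇒many-blue _ _ (suc m) p' (count-red+count-blue hubColours r)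
                      (≤-pred (red-hub-edges<p c no-red r ≤-refl))
      selected = select blue hubColours r (suc m) enough-blue
      τ = proj₁ selected
      τ-mono = proj₁ (proj₂ selected)
      τ<r = proj₁ (proj₂ (proj₂ selected))
      star = hubStar-copy blue (suc m) τ c τ-mono τ<r (proj₂ (proj₂ (proj₂ selected)))
      in-L = forced-in-block (τ m) (τ<r m ≤-refl)
               (block-from-m (τ m) (strictMonoOn-id≤ τ-mono m ≤-refl) (τ<r m ≤-refl)) L-forced no-red
      φ₂ = proj₁ in-L
      C₂ = proj₁ (proj₂ in-L)
      φ₂-0 = proj₂ (proj₂ in-L)

    cB : Coloring
    cB _ _ = blue

    open Colouring⋆ cB cL cL

    φ₂ : ℕ → ℕ
    φ₂ y = start last + φL y

    agree : hubStar pointsAndLast (suc m) ≡ φ₂ 0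
    agree = trans (cong start (extendLast-≡ m (λ x → x) last)) (sym (trans (cong (start last +_) φL-0) (start+0 last)))

    Φ : ℕ → ℕ
    Φ = glue (suc m) (hubStar pointsAndLast) φ₂

    Φ-blue : IsMonoCopy blue (H (suc i)) F c Φ
    Φ-blue = glue-copy S designed-star (lift-from-last φL-blue) agree

    Φ-leaf : ∀ x → x < m → Φ (suc x) ≡ start x
    Φ-leaf x x<m = trans (glue-≤ (suc m) _ φ₂ (suc x) (s≤s (<⇒≤ x<m))) (cong start (extendLast-< m (λ x → x) last x x<m))

    Φ-L : ∀ y → Φ (suc m + y) ≡ start last + φL y
    Φ-L y = glue-+ (suc m) _ φ₂ y agree

    n-H-suc : n (H (suc i)) ≡ suc (suc m + Hseg-last d 1 i)
    n-H-suc = Split.n-whole S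

    data Position (x : ℕ) : Set where
      centre : x ≡ 0 → Position x
      leaf : ∀ x' → x ≡ suc x' → x' < m → Position x
      in-L : ∀ y → x ≡ suc m + y → y < n (H i) → Position x

    position : ∀ x → x < n (H (suc i)) → Position x
    position x x<n with ≤-or-shifted (suc m) x
    ... | inj₂ (y , refl , _) = in-L y refl (subst (y <_) (sym (n-Hseg d 1 i))
                                  (+-cancelˡ-< (suc m) y _ (subst (suc m + y <_) (trans n-H-suc (sym (+-suc (suc m) _))) x<n)))
    ... | inj₁ x≤ with x
    ...   | zero = centre refl
    ...   | suc x' with x' <? m
    ...     | yes x'<m = leaf x' refl x'<m
    ...     | no x'≮m = in-L 0 (cong suc (trans (≤-antisym (≤-pred x≤) (≮⇒≥ x'≮m)) (sym (+-identityʳ m)))) (0<n-Hseg 1 i)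

    leaf<n : ∀ x → x < m → suc x < n (H (suc i))
    leaf<n x x<m = subst (suc x <_) (sym n-H-suc) (s≤s (≤-trans (≤-trans x<m (n≤1+n m)) (m≤m+n (suc m) _)))

    L<n : ∀ y → y < n (H i) → suc m + y < n (H (suc i))
    L<n y y<n = subst (suc m + y <_) (trans (+-suc (suc m) _) (sym n-H-suc)) (+-monoʳ-< (suc m) (subst (y <_) (n-Hseg d 1 i) y<n))

    φL<n : ∀ y → y < n (H i) → φL y < n (block last)
    φL<n y y<n = subst (φL y <_) (cong n (sym block-last)) (copy-bound φL-blue y y<n)

    0≢start+ : ∀ t a → 0 ≢ start t + a
    0≢start+ t a eq = <-irrefl eq (hub<start+ t a)

    Φ-induced : ∀ x y → x < n (H (suc i)) → y < n (H (suc i)) → Edge F (Φ x) (Φ y) → c (Φ x) (Φ y) ≡ blue →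
      Edge (H (suc i)) x y
    Φ-induced x y x<n y<n e blue-e with position x x<n | position y y<n
                                     | strictMonoOn-reflects-< (copy-mono Φ-blue) x y x<n (proj₁ e)
    ... | centre refl | centre refl | ()
    ... | centre refl | leaf y' refl y'<m | _ = Split.edge-left S 0 (suc y') (rightStar-edge (suc m) y' (≤-trans y'<m (n≤1+n m)))
    -- The hub meets the copy in the last block only at its first vertex.
    ... | centre refl | in-L y₀ refl y₀<n | _ with hub-neighbour _ (subst (Edge F hub) (Φ-L y₀) e)
    ...   | (t , _ , eq) with start-injective last t (φL y₀) 0 (φL<n y₀ y₀<n) (block≢∅ t) (trans eq (sym (start+0 t)))
    ...     | refl , φLy₀≡0 with strictMonoOn-injective (copy-mono φL-blue) y₀ 0 y₀<n (0<n-Hseg 1 i) (trans φLy₀≡0 (sym φL-0))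
    ...       | refl = subst (Edge (H (suc i)) 0) (sym (+-identityʳ (suc m))) (Split.edge-left S 0 (suc m) (rightStar-edge (suc m) m ≤-refl))
    Φ-induced x y x<n y<n e blue-e | leaf x' refl x'<m | _ | _ = ⊥-elim (point-block-no-edge x' _ (block-point x' x'<m) (subst (λ u → Edge F u (Φ y)) (Φ-leaf x' x'<m) e))
    Φ-induced x y x<n y<n e blue-e | in-L x₀ refl _ | centre refl | ()
    Φ-induced x y x<n y<n e blue-e | in-L x₀ refl _ | leaf y' refl y'<m | x<y =
      ⊥-elim (<-irrefl refl (<-≤-trans x<y (s≤s (≤-trans (<⇒≤ y'<m) (m≤m+n m x₀)))))
    Φ-induced x y x<n y<n e blue-e | in-L x₀ refl x₀<n | in-L y₀ refl y₀<n | _ =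
      Split.edge-right S x₀ y₀ (proj₁ φL-isolated x₀ y₀ x₀<n y₀<n
        (subst (λ X → Edge X (φL x₀) (φL y₀)) block-last (block-edge⁻ last _ _ (φL<n x₀ x₀<n) (subst₂ (Edge F) (Φ-L x₀) (Φ-L y₀) e)))
        (trans (sym (colour-last _ _ (copy-bound φL-blue x₀ x₀<n) (copy-bound φL-blue y₀ y₀<n)))
               (subst₂ (λ u v → c u v ≡ blue) (Φ-L x₀) (Φ-L y₀) blue-e)))

    copy-vertex-in-block : ∀ t a → a < n (block t) → InCopy (H (suc i)) Φ (start t + a) →
      (t < m × a ≡ 0) ⊎ (t ≡ last × InCopy (H i) φL a)
    copy-vertex-in-block t a a<n (x , x<n , Φx≡) with position x x<n
    ... | centre refl = ⊥-elim (0≢start+ t a Φx≡)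
    ... | leaf x' refl x'<m with start-injective x' t 0 a (block≢∅ x') a<n (trans (start+0 x') (trans (sym (Φ-leaf x' x'<m)) Φx≡))
    ...   | refl , refl = inj₁ (x'<m , refl)
    copy-vertex-in-block t a a<n (x , x<n , Φx≡) | in-L y refl y<n
      with start-injective last t (φL y) a (φL<n y y<n) a<n (trans (sym (Φ-L y)) Φx≡)
    ... | refl , refl = inj₂ (refl , y , y<n , refl)

    lift-L-vertex : ∀ a → InCopy (H i) φL a → InCopy (H (suc i)) Φ (start last + a)
    lift-L-vertex a (y , y<n , refl) = suc m + y , L<n y y<n , Φ-L y

    Φ-isolated : ∀ u v → Edge F u v → c u v ≡ blue → InCopy (H (suc i)) Φ u ⊎ InCopy (H (suc i)) Φ v →
      InCopy (H (suc i)) Φ u × InCopy (H (suc i)) Φ v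
    Φ-isolated u v e blue-e meets with edge⁻ _ _ e
    ... | inj₁ eB = ⊥-elim (point-edgeless _ _ eB)
    ... | inj₂ (inj₁ (refl , t , t<r , refl)) with hubColour-blue⁻ t t<r (trans (sym (colour-hub t t<r)) blue-e)
    ...   | inj₁ t<m = (0 , 0<n-Hseg 1 (suc i) , refl) , (suc t , leaf<n t t<m , Φ-leaf t t<m)
    ...   | inj₂ refl = (0 , 0<n-Hseg 1 (suc i) , refl) ,
                        (suc m + 0 , L<n 0 (0<n-Hseg 1 i) , trans (Φ-L 0) (trans (cong (start last +_) φL-0) (start+0 last)))
    Φ-isolated u v e blue-e meets | inj₂ (inj₂ (t , a , b , t<r , refl , refl , e')) =
      both
      where
      a<n = Edge⇒source<n {block t} e'
      b<n = Edge⇒<n {block t} e'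
      no-point : ¬ t < m
      no-point t<m = point-edgeless a b (subst (λ X → Edge X a b) (block-point t t<m) e')
      in-last : ∀ {w} → w < n (block t) → InCopy (H (suc i)) Φ (start t + w) → t ≡ last × InCopy (H i) φL w
      in-last w<n w∈Φ with copy-vertex-in-block t _ w<n w∈Φ
      ... | inj₁ (t<m , _) = ⊥-elim (no-point t<m)
      ... | inj₂ result = result
      t≡last : t ≡ last
      t≡last = [ (λ w∈Φ → proj₁ (in-last a<n w∈Φ)) , (λ w∈Φ → proj₁ (in-last b<n w∈Φ)) ]′ meets
      both : InCopy (H (suc i)) Φ (start t + a) × InCopy (H (suc i)) Φ (start t + b)
      both with t≡last
      ... | refl = Data.Product.map (lift-L-vertex a) (lift-L-vertex b) (proj₂ φL-isolated a b
                     (subst (λ X → Edge X a b) block-last e')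
                     (trans (sym (colour-last a b (subst (a <_) (cong n block-last) a<n) (subst (b <_) (cong n block-last) b<n))) blue-e)
                     (Data.Sum.map (λ w∈Φ → proj₂ (in-last a<n w∈Φ)) (λ w∈Φ → proj₂ (in-last b<n w∈Φ)) meets))

    Φ-unique : ∀ ψ → IsMonoCopy blue (H (suc i)) F c ψ → ψ 0 ≡ 0 → SameCopy (H (suc i)) Φ ψ
    Φ-unique ψ C ψ₀≡0 = same
      where
      star = copy-left S C
      decomposition = hubStar-decomposition star ψ₀≡0
      τ = proj₁ decomposition
      τ<r = proj₁ (proj₂ (proj₂ decomposition))
      ψ≡ = proj₂ (proj₂ (proj₂ decomposition))
      blue-τ : ∀ x → x < suc m → hubColour (τ x) ≡ blue
      blue-τ x lt = trans (sym (colour-hub (τ x) (τ<r x lt)))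
                      (subst₂ (λ a b → c a b ≡ blue) ψ₀≡0 (ψ≡ x lt) (copy-colour star 0 (suc x) (rightStar-edge (suc m) x lt)))
      τ-fixed = strictMonoOn-below-or-top m last τ (proj₁ (proj₂ decomposition))
                  (λ x x≤m → hubColour-blue⁻ (τ x) (τ<r x (s≤s x≤m)) (blue-τ x (s≤s x≤m)))
      tail = copy-right S C
      tail-start : ψ (suc m + 0) ≡ start last + 0
      tail-start = trans (cong ψ (+-identityʳ (suc m))) (trans (ψ≡ m ≤-refl) (trans (cong start (proj₂ τ-fixed)) (sym (start+0 last))))
      tail∈last : InBlock last (ψ (suc m + 0))
      tail∈last = 0 , block≢∅ last , tail-start
      same-L = φL-unique _ (restrict-to-last (Hseg-leftRooted d 1 i) tail tail∈last)
                 (trans (cong (_∸ start last) tail-start) (m+n∸m≡n (start last) 0))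
      ψ-L : ∀ y → y < n (H i) → ψ (suc m + y) ≡ start last + φL y
      ψ-L y y<n = trans (sym (m+[n∸m]≡n (InBlock-start≤ last _ (copy-InBlock last (Hseg-leftRooted d 1 i) tail tail∈last y y<n))))
                        (cong (start last +_) (sym (same-L y y<n)))
      same : SameCopy (H (suc i)) Φ ψ
      same x x<n with position x x<n
      ... | centre refl = sym ψ₀≡0
      ... | leaf x' refl x'<m = trans (Φ-leaf x' x'<m) (sym (trans (ψ≡ x' (≤-trans x'<m (n≤1+n m))) (cong start (proj₁ τ-fixed x' x'<m))))
      ... | in-L y refl y<n = trans (Φ-L y) (sym (ψ-L y y<n))

    Φ-no-blue-above : ∀ k → suc i < k → ¬ HasCopy blue (H k) F c
    Φ-no-blue-above k i<k (ψ , C) with region (ψ 0) (copy-bound C 0 (0<n-Hseg 1 k))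
    ... | inj₁ ψ₀<1 = <-irrefl refl (<-≤-trans (Hseg-last-< (suc i) k i<k) (≤-pred (subst₂ _≤_ (n-Hseg d 1 k) (n-Hseg d 1 (suc i))
          (isolated-component-bound (Hseg-leftRooted d 1 k) Φ-blue (Φ-induced , Φ-isolated) C 0 (0<n-Hseg 1 k)
             (0 , 0<n-Hseg 1 (suc i) , sym (n≤0⇒n≡0 (≤-pred ψ₀<1)))))))
    ... | inj₂ (t , t<r , ψ₀∈t) =
          [ L-no-blue-above k (<-trans (n<1+n i) i<k) , (λ (_ , in-T) → L-no-blue-above k (<-trans (n<1+n i) i<k) in-T) ]′
            (copy-in-block t t<r (1<n-H k (≤-trans (s≤s z≤n) i<k)) (Hseg-leftRooted d 1 k) C ψ₀∈t)

    strongLeftDeterminer : StrongLeftDeterminer (suc i) F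
    strongLeftDeterminer = record
      { nonempty = z<s
      ; forced = F-forced
      ; colouring = c
      ; no-red = no-red-star (no-red-in-point cB) L-no-red L-no-red
      ; no-blue-above = Φ-no-blue-above
      ; copy = Φ
      ; copy-blue = Φ-blue
      ; copy-0 = refl
      ; copy-unique = Φ-unique
      ; copy-isolated = Φ-induced , Φ-isolated
      }

  strongLeftDeterminer-exists : ∀ i → Σ OGraph (StrongLeftDeterminer i)
  strongLeftDeterminer-exists zero = point , point-strongLeftDeterminer
  strongLeftDeterminer-exists (suc i) with strongLeftDeterminer-exists i
  ... | (L , ld) = _ , LeftStep.strongLeftDeterminer i L ld (d (suc i) ∸ 1) (d≡suc (suc i) (s≤s z≤n))

  strong⇒leftDeterminer : ∀ {i F} → StrongLeftDeterminer i F → LeftDeterminer (rightStar p) d i F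
  strong⇒leftDeterminer {i} {F} ld =
    (λ c no-red → let (φ , C , φ₀≡0) = forced c (¬HasMonoCopy⇒¬HasCopy no-red) in φ , toMonoCopy C , (0 , 0<n-Hseg 1 i , φ₀≡0)) ,
    colouring , ¬HasCopy⇒¬HasMonoCopy no-red , ¬HasCopy⇒¬HasMonoCopy (no-blue-above (suc i) ≤-refl) ,
    copy , toMonoCopy copy-blue , (0 , 0<n-Hseg 1 i , copy-0) ,
    unique , copy-isolated
    where
    open StrongLeftDeterminer ld
    unique : ∀ ψ → MonoCopy blue (H i) F colouring ψ → ContainsLeftmost (H i) F ψ → SameCopy (H i) copy ψ
    unique ψ C ψ∋0 = copy-unique ψ C′ (InCopy-0 C′ ψ∋0)
      where C′ : IsMonoCopy blue (H i) F colouring ψ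
            C′ = fromMonoCopy C

  module RightDeterminers (i : ℕ) where
    -- A right determiner for H_i^j with k = i + 1 - j stars, the copy pinned at its last vertex.
    record StrongRightDeterminer (j k : ℕ) (F : OGraph) : Set where
      field
        nonempty : 0 < n F
        forced : ∀ c → NoRedStar F c → ¬ HasCopy blue (H i) F c →
          Σ (ℕ → ℕ) λ φ → IsMonoCopy blue (Hseg d j k) F c φ × φ (Hseg-last d j k) ≡ n F ∸ 1
        colouring : Coloring
        no-red : NoRedStar F colouring
        no-blue : ¬ HasCopy blue (H i) F colouring
        copy : ℕ → ℕ
        copy-blue : IsMonoCopy blue (Hseg d j k) F colouring copy
        copy-last : copy (Hseg-last d j k) ≡ n F ∸ 1
        copy-unique : ∀ ψ → IsMonoCopy blue (Hseg d j k) F colouring ψ → ψ (Hseg-last d j k) ≡ n F ∸ 1 →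
          SameCopy (Hseg d j k) copy ψ
        copy-isolated : InducedIsolatedBlue (Hseg d j k) F colouring copy

    point-strongRightDeterminer : 1 ≤ i → StrongRightDeterminer (suc i) 0 point
    point-strongRightDeterminer i≥1 = record
      { nonempty = z<s
      ; forced = λ c _ _ → (λ _ → 0) , point-copy blue c , refl
      ; colouring = λ _ _ → blue
      ; no-red = no-red-in-point _
      ; no-blue = λ (_ , C) → ¬copy-into-smaller (1<n-H i i≥1) C
      ; copy = λ _ → 0
      ; copy-blue = point-copy blue _
      ; copy-last = refl
      ; copy-unique = λ ψ _ ψ₀≡0 → point-same _ ψ (sym ψ₀≡0)
      ; copy-isolated = point-isolated _
      }

    module RightStep (j' k : ℕ) (i≡ : suc j' + suc k ≡ suc i) (j'≥1 : 1 ≤ j') (R : OGraph)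
                     (rd : StrongRightDeterminer (suc (suc j')) k R) (m : ℕ) (d≡ : d (suc j') ≡ suc m) where
      j : ℕ
      j = suc j'

      open StrongRightDeterminer rd using () renaming
        (nonempty to R≢∅; forced to R-forced; colouring to cR; no-red to R-no-red; no-blue to R-no-blue;
         copy to φR; copy-blue to φR-blue; copy-last to φR-last; copy-unique to φR-unique; copy-isolated to φR-isolated)
      L : OGraph
      L = proj₁ (strongLeftDeterminer-exists j')
      open StrongLeftDeterminer (proj₂ (strongLeftDeterminer-exists j')) using () renaming
        (nonempty to L≢∅; forced to L-forced; colouring to cL; no-red to L-no-red; no-blue-above to L-no-blue-above)
      open StarGadget p' R R≢∅ m L point L≢∅ z<s hiding (p)

      G₁ : OGraph
      G₁ = Hseg d (suc j) k
      N₁ : ℕ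
      N₁ = Hseg-last d (suc j) k
      G : OGraph
      G = Hseg d j (suc k)
      N : ℕ
      N = Hseg-last d j (suc k)

      S : Split G G₁ (rightStar (suc m)) N₁ (suc m)
      S = Hseg-split-lastStar d j k m d≡

      N≡ : N ≡ N₁ + suc m
      N≡ = suc-injective (trans (sym (n-Hseg d j (suc k))) (Split.n-whole S))

      SH : Split (H i) G (H j') N (Hseg-last d 1 j')
      SH = subst (λ a → Split (Hseg d 1 a) G (H j') N (Hseg-last d 1 j')) (trans (+-comm (suc k) j') (suc-injective i≡))
                 (Hseg-split d 1 (suc k) j')

      start-last≡ : start last ≡ n F ∸ 1
      start-last≡ = sym (cong (_∸ 1) (trans (cong (n R +_) (trans (blockOffset-suc block last)
                      (trans (cong (blockOffset block last +_) (cong n block-last)) (+-comm _ 1)))) (+-suc (n R) _)))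

      no-in-R : ∀ {col G' c} → ¬ HasCopy col G' F c → ¬ HasCopy col G' R c
      no-in-R none (ψ , C) = none (ψ , lift-from-B C)

      forced-in-R : ∀ c → NoRedStar F c → ¬ HasCopy blue (H i) F c →
        Σ (ℕ → ℕ) λ φ → IsMonoCopy blue G₁ F c φ × φ N₁ ≡ hub
      forced-in-R c no-red no-blue =
        let (φ , C , φ-last) = R-forced c (no-in-R no-red) (no-in-R no-blue) in φ , lift-from-B C , φ-last

      -- Otherwise the (m + 1)-st blue hub edge reaches a copy of L and completes a blue H i.
      last-hub-edge-blue : ∀ c → NoRedStar F c → ¬ HasCopy blue (H i) F c → c hub (start last) ≡ blue
      last-hub-edge-blue c no-red no-blue with c hub (start last) ≟ᶜ blue
      ... | yes blue-last = blue-last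
      ... | no red-last = ⊥-elim (no-blue (glue N Φ₁ φ₃ , glue-copy SH Φ₁-blue C₃ Φ₁-N))
        where
        R-part = forced-in-R c no-red no-blue
        hubColours = λ t → c hub (start t)
        few-red : suc (count red hubColours last) ≤ p'
        few-red = ≤-pred (subst (_< p) (count-suc-≡ red hubColours last (≢blue⇒≡red red-last))
                    (red-hub-edges<p c no-red r ≤-refl))
        selected = select blue hubColours last (suc m)
                     (few-red⇒many-blue _ _ (suc m) p' (cong suc (count-red+count-blue hubColours last)) few-red)
        τ = proj₁ selected
        τ-mono = proj₁ (proj₂ selected)
        τ<last = proj₁ (proj₂ (proj₂ selected))
        star = hubStar-copy blue (suc m) τ c τ-mono (λ x lt → ≤-trans (τ<last x lt) (n≤1+n last)) (proj₂ (proj₂ (proj₂ selected)))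
        Φ₁ = glue N₁ (proj₁ R-part) (hubStar τ)
        Φ₁-blue = glue-copy S (proj₁ (proj₂ R-part)) star (proj₂ (proj₂ R-part))
        in-L = forced-in-block (τ m) (≤-trans (τ<last m ≤-refl) (n≤1+n last))
                 (block-L (τ m) (strictMonoOn-id≤ τ-mono m ≤-refl) (τ<last m ≤-refl)) L-forced no-red
        φ₃ = proj₁ in-L
        C₃ = proj₁ (proj₂ in-L)
        Φ₁-N : Φ₁ N ≡ φ₃ 0
        Φ₁-N = trans (cong Φ₁ N≡) (trans (glue-+ N₁ _ (hubStar τ) (suc m) (proj₂ (proj₂ R-part))) (sym (proj₂ (proj₂ in-L))))

      F-forced : ∀ c → NoRedStar F c → ¬ HasCopy blue (H i) F c →
        Σ (ℕ → ℕ) λ φ → IsMonoCopy blue G F c φ × φ N ≡ n F ∸ 1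
      F-forced c no-red no-blue =
        glue N₁ φ₁ (hubStar (extendLast m τ last)) , glue-copy S C₁ star φ₁-last ,
        trans (cong (glue N₁ φ₁ _) N≡) (trans (glue-+ N₁ φ₁ _ (suc m) φ₁-last) (trans (cong start (extendLast-≡ m τ last)) start-last≡))
        where
        R-part = forced-in-R c no-red no-blue
        φ₁ = proj₁ R-part
        C₁ = proj₁ (proj₂ R-part)
        φ₁-last = proj₂ (proj₂ R-part)
        hubColours = λ t → c hub (start t)
        enough-blue : m ≤ count blue hubColours last
        enough-blue = few-red⇒many-blue _ _ m p' (count-red+count-blue hubColours last)
                        (≤-pred (≤-<-trans (count-≤-suc red hubColours last) (red-hub-edges<p c no-red r ≤-refl)))
        selected = select blue hubColours last m enough-blue
        τ = proj₁ selected
        star = star-to-last c τ (proj₁ (proj₂ selected)) (proj₁ (proj₂ (proj₂ selected))) (proj₂ (proj₂ (proj₂ selected)))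
                 (last-hub-edge-blue c no-red no-blue)

      cT : Coloring
      cT _ _ = blue

      open Colouring⋆ cR cL cT

      Φ : ℕ → ℕ
      Φ = glue N₁ φR (hubStar pointsAndLast)

      Φ-blue : IsMonoCopy blue G F c Φ
      Φ-blue = glue-copy S (lift-from-B (copy-recolour φR-blue (λ x y _ y<n → sym (colour-B x y y<n)))) designed-star φR-last

      Φ-R : ∀ x → x ≤ N₁ → Φ x ≡ φR x
      Φ-R = glue-≤ N₁ φR (hubStar pointsAndLast)

      Φ-leaf : ∀ y → y < m → Φ (N₁ + suc y) ≡ start y
      Φ-leaf y y<m = trans (glue-+ N₁ φR _ (suc y) φR-last) (cong start (extendLast-< m (λ x → x) last y y<m))

      Φ-top : Φ (N₁ + suc m) ≡ start last
      Φ-top = trans (glue-+ N₁ φR _ (suc m) φR-last) (cong start (extendLast-≡ m (λ x → x) last))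

      Φ-N₁ : Φ N₁ ≡ hub
      Φ-N₁ = trans (Φ-R N₁ ≤-refl) φR-last

      n-G : n G ≡ suc (N₁ + suc m)
      n-G = Split.n-whole S

      ≤N₁⇒<n-G₁ : ∀ {x} → x ≤ N₁ → x < n G₁
      ≤N₁⇒<n-G₁ x≤N₁ = subst (_ <_) (sym (n-Hseg d (suc j) k)) (s≤s x≤N₁)

      ≤N₁⇒<n-G : ∀ {x} → x ≤ N₁ → x < n G
      ≤N₁⇒<n-G x≤N₁ = subst (_ <_) (sym n-G) (s≤s (≤-trans x≤N₁ (m≤m+n _ _)))

      leaf<n-G : ∀ y → y ≤ m → N₁ + suc y < n G
      leaf<n-G y y≤m = subst (N₁ + suc y <_) (sym n-G) (s≤s (+-monoʳ-≤ N₁ (s≤s y≤m)))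

      data Position (x : ℕ) : Set where
        in-R : x ≤ N₁ → Position x
        leaf : ∀ y → x ≡ N₁ + suc y → y < m → Position x
        top : x ≡ N₁ + suc m → Position x

      position : ∀ x → x < n G → Position x
      position x x<n with ≤-or-shifted N₁ x
      ... | inj₁ x≤N₁ = in-R x≤N₁
      ... | inj₂ (suc y , refl , _) with y <? m
      ...   | yes y<m = leaf y refl y<m
      ...   | no y≮m = top (cong (λ z → N₁ + suc z) (≤-antisym y≤m (≮⇒≥ y≮m)))
        where y≤m = ≤-pred (+-cancelˡ-≤ N₁ _ _ (≤-pred (subst (N₁ + suc y <_) n-G x<n)))

      φR<n : ∀ x → x ≤ N₁ → φR x < n R
      φR<n x x≤N₁ = copy-bound φR-blue x (≤N₁⇒<n-G₁ x≤N₁)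

      start≮nR : ∀ t → ¬ start t < n R
      start≮nR t lt = start+≮nB t 0 (subst (_< n R) (sym (start+0 t)) lt)

      Φ<nR⇒≤N₁ : ∀ x → x < n G → Φ x < n R → x ≤ N₁
      Φ<nR⇒≤N₁ x x<n Φx<nR with position x x<n
      ... | in-R x≤N₁ = x≤N₁
      ... | leaf y refl y<m = ⊥-elim (start≮nR y (subst (_< n R) (Φ-leaf y y<m) Φx<nR))
      ... | top refl = ⊥-elim (start≮nR last (subst (_< n R) Φ-top Φx<nR))

      copy-vertex-in-block : ∀ t a → a < n (block t) → InCopy G Φ (start t + a) → block t ≡ point
      copy-vertex-in-block t a a<n (x , x<n , Φx≡) with position x x<n
      ... | in-R x≤N₁ = ⊥-elim (start+≮nB t a (subst (_< n R) (trans (sym (Φ-R x x≤N₁)) Φx≡) (φR<n x x≤N₁)))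
      ... | leaf y refl y<m with start-injective y t 0 a (block≢∅ y) a<n (trans (start+0 y) (trans (sym (Φ-leaf y y<m)) Φx≡))
      ...   | refl , _ = block-point y y<m
      copy-vertex-in-block t a a<n (x , x<n , Φx≡) | top refl
        with start-injective last t 0 a (block≢∅ last) a<n (trans (start+0 last) (trans (sym Φ-top) Φx≡))
      ... | refl , _ = block-last

      star-edge-at-N₁ : ∀ z → z ≤ m → Edge G N₁ (N₁ + suc z)
      star-edge-at-N₁ z z≤m = subst (λ w → Edge G w (N₁ + suc z)) (+-identityʳ N₁)
                                (Split.edge-right S 0 (suc z) (rightStar-edge (suc m) z (s≤s z≤m)))

      Φ-induced : ∀ x y → x < n G → y < n G → Edge F (Φ x) (Φ y) → c (Φ x) (Φ y) ≡ blue → Edge G x y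
      Φ-induced x y x<n y<n e blue-e with edge⁻ _ _ e
      ... | inj₁ eB = Split.edge-left S x y (proj₁ φR-isolated x y (≤N₁⇒<n-G₁ x≤N₁) (≤N₁⇒<n-G₁ y≤N₁)
              (subst₂ (Edge R) (Φ-R x x≤N₁) (Φ-R y y≤N₁) eB)
              (trans (sym (colour-B _ _ (φR<n y y≤N₁))) (subst₂ (λ a b → c a b ≡ blue) (Φ-R x x≤N₁) (Φ-R y y≤N₁) blue-e)))
        where
        y≤N₁ = Φ<nR⇒≤N₁ y y<n (Edge⇒<n {R} eB)
        x≤N₁ = Φ<nR⇒≤N₁ x x<n (Edge⇒source<n {R} eB)
      ... | inj₂ (inj₂ (t , a , _ , _ , Φx≡ , _ , e')) =
            ⊥-elim (point-edgeless _ _ (subst (λ X → Edge X _ _) (copy-vertex-in-block t a (Edge⇒source<n {block t} e') (x , x<n , Φx≡)) e'))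
      ... | inj₂ (inj₁ (Φx≡hub , t , _ , Φy≡))
        with position y y<n | strictMonoOn-injective (copy-mono Φ-blue) x N₁ x<n (≤N₁⇒<n-G ≤-refl) (trans Φx≡hub (sym Φ-N₁))
      ...   | in-R y≤N₁ | _ = ⊥-elim (start≮nR t (subst (_< n R) (trans (sym (Φ-R y y≤N₁)) Φy≡) (φR<n y y≤N₁)))
      ...   | leaf y' refl y'<m | refl = star-edge-at-N₁ y' (<⇒≤ y'<m)
      ...   | top refl | refl = star-edge-at-N₁ m ≤-refl

      lift-R-vertex : ∀ w → InCopy G₁ φR w → InCopy G Φ w
      lift-R-vertex w (x , x<n , refl) = x , ≤N₁⇒<n-G x≤N₁ , Φ-R x x≤N₁
        where x≤N₁ = ≤-pred (subst (x <_) (n-Hseg d (suc j) k) x<n)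

      R-vertex : ∀ w → w < n R → InCopy G Φ w → InCopy G₁ φR w
      R-vertex w w<n (x , x<n , refl) = x , ≤N₁⇒<n-G₁ x≤N₁ , sym (Φ-R x x≤N₁)
        where x≤N₁ = Φ<nR⇒≤N₁ x x<n w<n

      Φ-isolated : ∀ u v → Edge F u v → c u v ≡ blue → InCopy G Φ u ⊎ InCopy G Φ v → InCopy G Φ u × InCopy G Φ v
      Φ-isolated u v e blue-e meets with edge⁻ _ _ e
      ... | inj₁ eB = Data.Product.map (lift-R-vertex u) (lift-R-vertex v) (proj₂ φR-isolated u v eB
                        (trans (sym (colour-B u v (Edge⇒<n {R} eB))) blue-e)
                        (Data.Sum.map (R-vertex u (Edge⇒source<n {R} eB)) (R-vertex v (Edge⇒<n {R} eB)) meets))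
      ... | inj₂ (inj₁ (refl , t , t<r , refl)) with hubColour-blue⁻ t t<r (trans (sym (colour-hub t t<r)) blue-e)
      ...   | inj₁ t<m = (N₁ , ≤N₁⇒<n-G ≤-refl , Φ-N₁) , (N₁ + suc t , leaf<n-G t (<⇒≤ t<m) , Φ-leaf t t<m)
      ...   | inj₂ refl = (N₁ , ≤N₁⇒<n-G ≤-refl , Φ-N₁) , (N₁ + suc m , leaf<n-G m ≤-refl , Φ-top)
      Φ-isolated u v e blue-e meets | inj₂ (inj₂ (t , a , b , _ , refl , refl , e')) =
        ⊥-elim (point-edgeless a b (subst (λ X → Edge X a b) block≡point e'))
        where block≡point = [ copy-vertex-in-block t a (Edge⇒source<n {block t} e') ,
                              copy-vertex-in-block t b (Edge⇒<n {block t} e') ]′ meets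

      Φ-unique : ∀ ψ → IsMonoCopy blue G F c ψ → ψ N ≡ n F ∸ 1 → SameCopy G Φ ψ
      Φ-unique ψ C ψ-N = same
        where
        tail = copy-right S C
        ψ-top : ψ (N₁ + suc m) ≡ start last
        ψ-top = trans (cong ψ (sym N≡)) (trans ψ-N (sym start-last≡))
        centre : ψ (N₁ + 0) ≡ hub
        centre = edge-into-start _ last (subst (Edge F _) ψ-top (copy-edge tail 0 (suc m) (rightStar-edge (suc m) m ≤-refl)))
        decomposition = hubStar-decomposition tail centre
        τ = proj₁ decomposition
        τ<r = proj₁ (proj₂ (proj₂ decomposition))
        ψ≡ = proj₂ (proj₂ (proj₂ decomposition))
        blue-τ : ∀ x → x < suc m → hubColour (τ x) ≡ blue
        blue-τ x lt = trans (sym (colour-hub (τ x) (τ<r x lt)))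
                        (subst₂ (λ a b → c a b ≡ blue) centre (ψ≡ x lt) (copy-colour tail 0 (suc x) (rightStar-edge (suc m) x lt)))
        τ-fixed = strictMonoOn-below-or-top m last τ (proj₁ (proj₂ decomposition))
                    (λ x x≤m → hubColour-blue⁻ (τ x) (τ<r x (s≤s x≤m)) (blue-τ x (s≤s x≤m)))
        head = copy-left S C
        ψ-N₁ : ψ N₁ ≡ hub
        ψ-N₁ = trans (cong ψ (sym (+-identityʳ N₁))) centre
        head-in-R : ∀ x → x < n G₁ → ψ x < n R
        head-in-R x x<n = ≤-<-trans (strictMonoOn⇒monoOn (copy-mono head) x N₁ (≤-pred (subst (x <_) (n-Hseg d (suc j) k) x<n))
                                       (≤N₁⇒<n-G₁ ≤-refl))
                                    (subst (_< n R) (sym ψ-N₁) hub<nB)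
        same-R = φR-unique ψ (copy-recolour (restrict-to-B head head-in-R) (λ x y _ y<n → colour-B x y y<n)) ψ-N₁
        same : SameCopy G Φ ψ
        same x x<n with position x x<n
        ... | in-R x≤N₁ = trans (Φ-R x x≤N₁) (same-R x (≤N₁⇒<n-G₁ x≤N₁))
        ... | leaf y refl y<m = trans (Φ-leaf y y<m) (sym (trans (ψ≡ y (≤-trans y<m (n≤1+n m))) (cong start (proj₁ τ-fixed y y<m))))
        ... | top refl = trans Φ-top (sym ψ-top)

      j'<i : j' < i
      j'<i = subst (j' <_) (suc-injective i≡) (subst (_≤ j' + suc k) (+-comm j' 1) (+-monoʳ-≤ j' (s≤s z≤n)))

      Φ-no-blue : ¬ HasCopy blue (H i) F c
      Φ-no-blue (ψ , C) with preimage? ψ hub (n (H i))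
      ... | inj₁ (x , x<n , ψx≡hub) = <-irrefl refl (<-≤-trans G<H (isolated-component-bound (Hseg-leftRooted d 1 i) Φ-blue
              (Φ-induced , Φ-isolated) C x x<n (N₁ , ≤N₁⇒<n-G ≤-refl , trans Φ-N₁ (sym ψx≡hub))))
        where
        G<H : n G < n (H i)
        G<H = subst₂ _<_ (sym (n-Hseg d j (suc k))) (sym (Split.n-whole SH))
                (s≤s (subst (_< N + Hseg-last d 1 j') (+-identityʳ N) (+-monoʳ-< N (Hseg-last-< 0 j' j'≥1))))
      ... | inj₂ avoids-hub with region (ψ 0) (copy-bound C 0 (0<n-Hseg 1 i))
      ...   | inj₁ ψ₀<nR = R-no-blue (ψ , copy-recolour (restrict-to-B C
                (stays-in-B (Hseg-leftRooted d 1 i) C (λ x y e → avoids-hub x (Edge⇒source<n {H i} e)) ψ₀<nR))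
                (λ x y _ y<n → colour-B x y y<n))
      ...   | inj₂ (t , t<r , ψ₀∈t) =
              [ L-no-blue-above i j'<i , (λ (_ , _ , in-point) → ¬copy-into-smaller (1<n-H i i≥1) in-point) ]′
                (copy-in-block t t<r (1<n-H i i≥1) (Hseg-leftRooted d 1 i) C ψ₀∈t)
        where i≥1 = ≤-trans (s≤s z≤n) j'<i

      strongRightDeterminer : StrongRightDeterminer j (suc k) F
      strongRightDeterminer = record
        { nonempty = ≤-trans R≢∅ (m≤m+n _ _)
        ; forced = F-forced
        ; colouring = c
        ; no-red = no-red-star R-no-red L-no-red (no-red-in-point cT)
        ; no-blue = Φ-no-blue
        ; copy = Φ
        ; copy-blue = Φ-blue
        ; copy-last = trans (cong Φ N≡) (trans Φ-top start-last≡)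
        ; copy-unique = Φ-unique
        ; copy-isolated = Φ-induced , Φ-isolated
        }

    strongRightDeterminer-exists : ∀ k j → j + k ≡ suc i → 2 ≤ j → Σ OGraph (StrongRightDeterminer j k)
    strongRightDeterminer-exists zero j j+0≡ 2≤j with trans (sym (+-identityʳ j)) j+0≡
    ... | refl = point , point-strongRightDeterminer (≤-pred 2≤j)
    strongRightDeterminer-exists (suc k) (suc j') i≡ (s≤s j'≥1) with strongRightDeterminer-exists k (suc (suc j'))
                                                                       (trans (sym (+-suc (suc j') k)) i≡) (s≤s (s≤s z≤n))
    ... | (R , rd) = _ , RightStep.strongRightDeterminer j' k i≡ j'≥1 R rd (d (suc j') ∸ 1) (d≡suc (suc j') (s≤s z≤n))

    strong⇒rightDeterminer : ∀ {j F} → StrongRightDeterminer j (suc i ∸ j) F → RightDeterminer (rightStar p) d i j F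
    strong⇒rightDeterminer {j} {F} rd =
      (λ c no-red no-blue → let (φ , C , φ-last) = forced c (¬HasMonoCopy⇒¬HasCopy no-red) (¬HasMonoCopy⇒¬HasCopy no-blue)
                            in φ , toMonoCopy C , (Hseg-last d j k , last<n , φ-last)) ,
      colouring , ¬HasCopy⇒¬HasMonoCopy no-red , ¬HasCopy⇒¬HasMonoCopy no-blue ,
      copy , toMonoCopy copy-blue , (Hseg-last d j k , last<n , copy-last) ,
      unique , copy-isolated
      where
      open StrongRightDeterminer rd
      k = suc i ∸ j
      last<n : Hseg-last d j k < n (Hseg d j k)
      last<n = subst (Hseg-last d j k <_) (sym (n-Hseg d j k)) ≤-refl
      unique : ∀ ψ → MonoCopy blue (Hseg d j k) F colouring ψ → ContainsRightmost (Hseg d j k) F ψ → SameCopy (Hseg d j k) copy ψ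
      unique ψ C ψ∋last = copy-unique ψ C′ (InCopy-last (n-Hseg d j k) nonempty C′ ψ∋last)
        where C′ : IsMonoCopy blue (Hseg d j k) F colouring ψ
              C′ = fromMonoCopy C

lemma22 : (p : ℕ) → 1 ≤ p → (d : ℕ → ℕ) → (∀ k → 1 ≤ k → 1 ≤ d k) →
    (i j : ℕ) → j ≤ suc i →
    (∃ λ F → LeftDeterminer (rightStar p) d i F) ×
    (2 ≤ j → ∃ λ F → RightDeterminer (rightStar p) d i j F)
lemma22 (suc p') _ d d≥1 i j j≤1+i =
  (_ , strong⇒leftDeterminer (proj₂ (strongLeftDeterminer-exists i))) ,
  (λ 2≤j → _ , strong⇒rightDeterminer (proj₂ (strongRightDeterminer-exists (suc i ∸ j) j (m+[n∸m]≡n j≤1+i) 2≤j)))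
  where
  open Determiners p' d d≥1
  open RightDeterminers i
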